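{- Let $k\geq 3$ be an odd integer, $G=\langle x,y:~x^{4k}=y^2=e,~yxy=x^{ -1}\rangle$, $A_1=\langle x^4\rangle$, $Z=x^2A_1\cup y(A_1\setminus\{x^{2(k-1)}\})\cup\{yx^{2k-1},yx^{ -2},yx^{ -1}\}$ and $\Sigma=\mathrm{Cay}(G,Z)$. Then the WL-rank of $\Sigma$ equals $6k$.
   Context: $\mathrm{Cay}(G,S)$ has vertex set $G$ and edges $\{g,sg\}$. The WL-rank of $\mathrm{Cay}(G,S)$ is the number of basic sets of the smallest S-ring over $G$ in which $S$ is a union of basic sets (equivalently, the number of classes of the coherent configuration generated by the graph). An S-ring over $G$ is a subring of $\mathbb{Z}G$ spanned by the elements $\sum_{x\in X}x$, $X$ ranging over a partition of $G$ (basic sets) containing $\{e\}$ and closed under inversion. -}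

module Defs where

open import Data.Nat using (ℕ; zero; suc; _+_; _*_; _∸_; NonZero; _%_; _≡ᵇ_)
open import Data.Nat.Properties using (m*n≢0)
open import Data.Nat.DivMod using (m%n<n)
open import Data.Bool using (Bool; true; false; _xor_; if_then_else_; _∧_; _∨_; not)
import Data.Bool.Properties as BoolP
open import Data.Fin using (Fin; toℕ; fromℕ<)
import Data.Fin.Properties as FinP
open import Data.Product using (Σ; ∃; _×_; _,_)
open import Data.Product.Properties using (≡-dec)
open import Data.List using (List; _∷_; []; length; filter; cartesianProduct; allFin)
open import Relation.Binary.PropositionalEquality using (_≡_)
open import Relation.Binary.Definitions using (DecidableEquality)
open import Relation.Nullary.Decidable using (_×-dec_)

-- The dihedral group G = ⟨x, y : x^(4k) = y^2 = e, y x y = x⁻¹⟩ of order 8k.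
-- An element (b , a) with b : Bool, a : Fin (4k) stands for the normal form
-- y^b x^a  (y^false = e, y^true = y).
module Dihedral (k : ℕ) .{{_ : NonZero k}} where

  n : ℕ
  n = 4 * k

  instance
    n≢0 : NonZero n
    n≢0 = m*n≢0 4 k

  md : ℕ → Fin n
  md a = fromℕ< (m%n<n a n)

  G : Set
  G = Bool × Fin n

  -- (y^b x^a)(y^d x^c) = y^(b+d) x^((-1)^d a + c)
  _·_ : G → G → G
  (b , a) · (d , c) =
    (b xor d , md ((if d then n ∸ toℕ a else toℕ a) + toℕ c))

  e : G
  e = (false , md 0)

  inv : G → G
  inv (false , a) = (false , md (n ∸ toℕ a))
  inv (true  , a) = (true  , a)

  _≟G_ : DecidableEquality G
  _≟G_ = ≡-dec BoolP._≟_ FinP._≟_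

  elems : List G
  elems = cartesianProduct (false ∷ true ∷ []) (allFin n)

  pairs : List (G × G)
  pairs = cartesianProduct elems elems

  -- A partition of G into r classes is given by a class map c : G → Fin r;
  -- basic sets are the fibres c⁻¹(i).
  -- count c i j z = coefficient of z in X_i · X_j (in ℤG)
  --               = #{(a , b) ∈ X_i × X_j : a · b = z}.
  count : {r : ℕ} → (G → Fin r) → Fin r → Fin r → G → ℕ
  count c i j z =
    length (filter (λ p → (FinP._≟_ (c (Data.Product.proj₁ p)) i
                          ×-dec FinP._≟_ (c (Data.Product.proj₂ p)) j)
                          ×-dec ((Data.Product.proj₁ p · Data.Product.proj₂ p) ≟G z))
                   pairs)

  IsSRing : {r : ℕ} → (G → Fin r) → Set
  IsSRing {r} c =
      (∀ i → ∃ λ g → c g ≡ i)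
    × (∀ g → c g ≡ c e → g ≡ e)                        -- {e} is a basic set
    × (∀ g h → c g ≡ c h → c (inv g) ≡ c (inv h))      -- X⁻¹ is a basic set
    × (∀ i j z z' → c z ≡ c z' → count c i j z ≡ count c i j z')
                                                       -- span closed under product

  UnionOfBasic : {r : ℕ} → (G → Bool) → (G → Fin r) → Set
  UnionOfBasic S c = ∀ g h → c g ≡ c h → S g ≡ S h

  -- The smallest S-ring in which S is a union of basic sets has exactly r
  -- basic sets: there is such an S-ring with r basic sets whose module is
  -- contained in (i.e. whose partition is coarser than) every S-ring in which
  -- S is a union of basic sets.  This r is the WL-rank of Cay(G , S).
  WLRank≡ : (G → Bool) → ℕ → Set
  WLRank≡ S r =
    Σ (G → Fin r) λ c →
        IsSRing c × UnionOfBasic S c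
      × (∀ (r' : ℕ) (d : G → Fin r') → IsSRing d → UnionOfBasic S d →
           ∀ g h → d g ≡ d h → c g ≡ c h)

  -- Z = x² A₁ ∪ y (A₁ ∖ {x^(2(k-1))}) ∪ {y x^(2k-1), y x^(-2), y x^(-1)},
  -- A₁ = ⟨x⁴⟩ = {x^a : 4 ∣ a}  (4 ∣ 4k, so this is well defined mod 4k).
  Z : G → Bool
  Z (false , a) = toℕ a % 4 ≡ᵇ 2
  Z (true  , a) =
       ((toℕ a % 4 ≡ᵇ 0) ∧ not (toℕ a ≡ᵇ 2 * (k ∸ 1)))
    ∨ (toℕ a ≡ᵇ 2 * k ∸ 1)
    ∨ (toℕ a ≡ᵇ n ∸ 2)
    ∨ (toℕ a ≡ᵇ n ∸ 1)

module Submission where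

-- The basic sets of the smallest S-ring containing Z are the singletons {g} with g of even
-- exponent and the pairs {g, g x²ᵏ} with g of odd exponent: 2k + k of them in each coset of
-- ⟨x⟩, 6k in all.  These pairs are the orbits of the involutive automorphism ψ that multiplies
-- the elements of odd exponent by the central involution x²ᵏ, and ψ fixes Z, so they form an
-- S-ring in which Z is a union of basic sets.
--
-- Conversely, take any S-ring in which Z is a union of basic sets.  The number of
-- factorisations z = ab with a, b ∈ Z is constant on its basic sets; it is 3 for yx⁻² and at
-- most 2 for every other element of Z, so {yx⁻²} is a basic set.  Translating by yx⁻² confines
-- the basic sets of yx⁻¹ and x to {x²ᵏ, yx²ᵏ⁻¹, yx⁻¹} and {x, x²ᵏ⁺¹}.  Since y = yx⁻¹·x, every
-- element of the basic set of y is a product of elements of these two sets lying in Z, and the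
-- only such product is y; so {y} is a basic set.  Then so are {x²} = {yx⁻²·y} and every {g}
-- with g of even exponent.  An element g of odd exponent is t·x with t even, so its basic set
-- lies in t·{x, x²ᵏ⁺¹} = {g, g x²ᵏ}.

open import Algebra.Bundles using (Group)
import Algebra.Properties.Group
open import Data.Bool using (Bool; true; false; not; _∧_; _∨_; _xor_; if_then_else_)
import Data.Bool as Bool
open import Data.Bool.Properties using (T-≡; ∨-zeroʳ; ¬-not; ⇔→≡; xor-assoc; xor-identityʳ)
open import Data.Empty using (⊥-elim)
open import Data.Fin using (Fin; zero; suc; toℕ; fromℕ<)
import Data.Fin.Properties as Fin
open import Data.List using (List; []; _∷_; length; filter; map; deduplicate)
open import Data.List.Membership.DecPropositional using () renaming (_∈?_ to ∈-dec)
open import Data.List.Membership.Propositional using (_∈_; lose)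
open import Data.List.Membership.Propositional.Properties
  using (∈-filter⁺; ∈-filter⁻; ∈-map⁺; ∈-deduplicate⁺; ∈-cartesianProduct⁺; ∈-allFin)
open import Data.List.Membership.Propositional.Properties.WithK using (unique∧set⇒bag)
open import Data.List.Properties using (length-filter; length-deduplicate; filter-≐; filter-some; filter-none)
open import Data.List.Relation.Binary.BagAndSetEquality using (∼bag⇒↭)
open import Data.List.Relation.Binary.Permutation.Propositional.Properties using (↭-length; filter-↭)
open import Data.List.Relation.Unary.All using (All)
import Data.List.Relation.Unary.All as All
import Data.List.Relation.Unary.AllPairs as AllPairs
open import Data.List.Relation.Unary.Any using (here; there)
open import Data.List.Relation.Unary.Unique.Propositional using (Unique)
import Data.List.Relation.Unary.Unique.Propositional.Properties as Unique
open import Data.List.Relation.Unary.Unique.DecPropositional.Properties using (deduplicate-!)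
open import Data.Nat
  using (ℕ; zero; suc; _+_; _*_; _∸_; _%_; _/_; _≤_; _<_; _≡ᵇ_; _<?_; z≤n; s≤s; z<s; s<s; NonZero; >-nonZero⁻¹)
open import Data.Nat.DivMod
open import Data.Nat.Divisibility using (_∣_; divides)
open import Data.Nat.Properties
open import Data.Nat.Tactic.RingSolver using (solve)
open import Algebra.Properties.CommutativeMonoid.Sum +-0-commutativeMonoid
  using (sum; ∑-distrib-+; sum-cong-≗; sum-replicate-zero)
open import Data.Product using (∃; _×_; _,_; proj₁; proj₂)
open import Data.Product.Properties using (≡-dec)
open import Data.Sum using (_⊎_; inj₁; inj₂)
open import Function using (_∘_; case_of_; mk⇔)
open import Function.Bundles using (Equivalence)
open import Level using (0ℓ)
open import Relation.Binary.Bundles using (Setoid)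
open import Relation.Binary.Definitions using (DecidableEquality)
open import Relation.Binary.PropositionalEquality
import Relation.Binary.Reasoning.Setoid as SetoidReasoning
open import Relation.Nullary using (Dec; ¬_; does; yes; no; _×-dec_)
open import Relation.Nullary.Decidable using (dec-true; dec-false)
open import Relation.Unary using (Pred; Decidable)
open import Defs

true≢false : true ≢ false
true≢false ()

≡ᵇ-true⇒≡ : ∀ {m n} → (m ≡ᵇ n) ≡ true → m ≡ n
≡ᵇ-true⇒≡ {m} {n} eq = ≡ᵇ⇒≡ m n (Equivalence.from T-≡ eq)

≡⇒≡ᵇ-true : ∀ {m n} → m ≡ n → (m ≡ᵇ n) ≡ true
≡⇒≡ᵇ-true {m} {n} eq = Equivalence.to T-≡ (≡⇒≡ᵇ m n eq)

≢⇒≡ᵇ-false : ∀ {m n} → m ≢ n → (m ≡ᵇ n) ≡ false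
≢⇒≡ᵇ-false {m} {n} m≢n with m ≡ᵇ n in eq
... | true  = ⊥-elim (m≢n (≡ᵇ-true⇒≡ eq))
... | false = refl

%2-cases : ∀ a → a % 2 ≡ 0 ⊎ a % 2 ≡ 1
%2-cases a = below-2 (a % 2) (m%n<n a 2)
  where
  below-2 : ∀ p → p < 2 → p ≡ 0 ⊎ p ≡ 1
  below-2 0 _ = inj₁ refl
  below-2 1 _ = inj₂ refl
  below-2 (suc (suc _)) (s≤s (s≤s ()))

/2-injective : ∀ {a b} → a % 2 ≡ b % 2 → a / 2 ≡ b / 2 → a ≡ b
/2-injective {a} {b} a%2≡b%2 a/2≡b/2 = begin
  a                   ≡⟨ m≡m%n+[m/n]*n a 2 ⟩
  a % 2 + a / 2 * 2   ≡⟨ cong₂ (λ r t → r + t * 2) a%2≡b%2 a/2≡b/2 ⟩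
  b % 2 + b / 2 * 2   ≡⟨ m≡m%n+[m/n]*n b 2 ⟨
  b                   ∎
  where open ≡-Reasoning

%-fibre : ∀ m .{{_ : NonZero m}} {a b} → a < 2 * m → b < 2 * m → a % m ≡ b % m →
          a ≡ b ⊎ b ≡ a + m ⊎ a ≡ b + m
%-fibre m {a} {b} a<2m b<2m a%m≡b%m =
  by-quotients (a / m) (b / m) (m<n*o⇒m/o<n a<2m) (m<n*o⇒m/o<n b<2m)
    (m≡m%n+[m/n]*n a m) (trans (m≡m%n+[m/n]*n b m) (cong (_+ b / m * m) (sym a%m≡b%m)))
  where
  r = a % m
  one-more : ∀ x → x + 1 * m ≡ x + 0 * m + m
  one-more x = solve (x ∷ m ∷ [])
  by-quotients : ∀ s t → s < 2 → t < 2 → a ≡ r + s * m → b ≡ r + t * m → a ≡ b ⊎ b ≡ a + m ⊎ a ≡ b + m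
  by-quotients 0 0 _ _ a≡ b≡ = inj₁ (trans a≡ (sym b≡))
  by-quotients 1 1 _ _ a≡ b≡ = inj₁ (trans a≡ (sym b≡))
  by-quotients 0 1 _ _ a≡ b≡ = inj₂ (inj₁ (trans b≡ (trans (one-more r) (cong (_+ m) (sym a≡)))))
  by-quotients 1 0 _ _ a≡ b≡ = inj₂ (inj₂ (trans a≡ (trans (one-more r) (cong (_+ m) (sym b≡)))))
  by-quotients (suc (suc _)) _ (s≤s (s≤s ())) _ _ _
  by-quotients _ (suc (suc _)) _ (s≤s (s≤s ())) _ _

-- Counting the elements of an enumerated type that satisfy a decidable predicate

module Counting {A : Set} (_≟_ : DecidableEquality A) where

  length-filter>0⇒∃ : ∀ {P : Pred A 0ℓ} (P? : Decidable P) xs →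
                      0 < length (filter P? xs) → ∃ λ x → x ∈ xs × P x
  length-filter>0⇒∃ P? xs _ with filter P? xs in eq
  ... | y ∷ _ = y , ∈-filter⁻ P? (subst (y ∈_) (sym eq) (here refl))

  unique-⊆⇒length≤ : ∀ {xs ys : List A} → Unique xs → (∀ {x} → x ∈ xs → x ∈ ys) →
                     length xs ≤ length ys
  unique-⊆⇒length≤ {xs} {ys} xs! xs⊆ys = begin
    length xs                    ≡⟨ ↭-length (∼bag⇒↭ (unique∧set⇒bag xs! ys′! (mk⇔ to from))) ⟩
    length ys′                   ≤⟨ length-filter ∈xs? (deduplicate _≟_ ys) ⟩
    length (deduplicate _≟_ ys)  ≤⟨ length-deduplicate _≟_ ys ⟩
    length ys                    ∎
    where
    open ≤-Reasoning
    ∈xs? : Decidable (_∈ xs)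
    ∈xs? y = ∈-dec _≟_ y xs
    ys′ = filter ∈xs? (deduplicate _≟_ ys)
    ys′! : Unique ys′
    ys′! = Unique.filter⁺ ∈xs? (deduplicate-! _≟_ ys)
    to : ∀ {x} → x ∈ xs → x ∈ ys′
    to x∈xs = ∈-filter⁺ ∈xs? (∈-deduplicate⁺ _≟_ (xs⊆ys x∈xs)) x∈xs
    from : ∀ {x} → x ∈ ys′ → x ∈ xs
    from x∈ys′ = proj₂ (∈-filter⁻ ∈xs? {xs = deduplicate _≟_ ys} x∈ys′)

  module _ {xs : List A} (xs! : Unique xs) (xs-complete : ∀ x → x ∈ xs) where

    length-filter-∘-involution : ∀ {P : Pred A 0ℓ} (P? : Decidable P) (φ : A → A) →
      (∀ x → φ (φ x) ≡ x) → length (filter P? xs) ≡ length (filter (P? ∘ φ) xs)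
    length-filter-∘-involution P? φ φ-involutive = begin
      length (filter P? xs)          ≡⟨ ↭-length (filter-↭ P? (∼bag⇒↭ xs∼φxs)) ⟩
      length (filter P? (map φ xs))  ≡⟨ length-filter-map xs ⟩
      length (filter (P? ∘ φ) xs)    ∎
      where
      open ≡-Reasoning
      φxs! : Unique (map φ xs)
      φxs! = Unique.map⁺ (λ {x} {y} φx≡φy → trans (sym (φ-involutive x))
                                                  (trans (cong φ φx≡φy) (φ-involutive y))) xs!
      ∈φxs : ∀ {x} → x ∈ xs → x ∈ map φ xs
      ∈φxs {x} _ = subst (_∈ map φ xs) (φ-involutive x) (∈-map⁺ φ (xs-complete (φ x)))
      xs∼φxs = unique∧set⇒bag xs! φxs! (mk⇔ ∈φxs (λ _ → xs-complete _))
      length-filter-map : ∀ ys → length (filter P? (map φ ys)) ≡ length (filter (P? ∘ φ) ys)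
      length-filter-map []       = refl
      length-filter-map (y ∷ ys) with does (P? (φ y))
      ... | true  = cong suc (length-filter-map ys)
      ... | false = length-filter-map ys

    length-filter-≥ : ∀ {P : Pred A 0ℓ} (P? : Decidable P) {ys} → Unique ys → All P ys →
                      length ys ≤ length (filter P? xs)
    length-filter-≥ P? ys! Pys =
      unique-⊆⇒length≤ ys! (λ y∈ys → ∈-filter⁺ P? (xs-complete _) (All.lookup Pys y∈ys))

    length-filter-≤ : ∀ {P : Pred A 0ℓ} (P? : Decidable P) {ys} → (∀ {x} → P x → x ∈ ys) →
                      length (filter P? xs) ≤ length ys
    length-filter-≤ P? P⊆ys =
      unique-⊆⇒length≤ (Unique.filter⁺ P? xs!) (λ x∈ → P⊆ys (proj₂ (∈-filter⁻ P? {xs = xs} x∈)))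

  indicator : ∀ {X : Set} → Dec X → ℕ
  indicator X? = if does X? then 1 else 0

  ∑-indicator : ∀ {r} (j : Fin r) → sum (λ i → indicator (j Fin.≟ i)) ≡ 1
  ∑-indicator {suc r} zero    = cong suc (sum-replicate-zero r)
  ∑-indicator {suc r} (suc j) = ∑-indicator j

  length-filter-∷ : ∀ {P : Pred A 0ℓ} (P? : Decidable P) x xs →
                    length (filter P? (x ∷ xs)) ≡ indicator (P? x) + length (filter P? xs)
  length-filter-∷ P? x xs with does (P? x)
  ... | true  = refl
  ... | false = refl

  length-filter-∑ : ∀ {r} {P : Pred A 0ℓ} (P? : Decidable P) (c : A → Fin r) xs →
    length (filter P? xs) ≡ sum (λ i → length (filter (λ x → P? x ×-dec c x Fin.≟ i) xs))
  length-filter-∑ {r} P? c [] = sym (sum-replicate-zero r)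
  length-filter-∑ {r} {P} P? c (x ∷ xs) = begin
    length (filter P? (x ∷ xs))
      ≡⟨ length-filter-∷ P? x xs ⟩
    indicator (P? x) + length (filter P? xs)
      ≡⟨ cong₂ _+_ (split-head (does (P? x))) (length-filter-∑ P? c xs) ⟩
    sum (λ i → indicator (Pᵢ i x)) + sum (λ i → #Pᵢ i xs)
      ≡⟨ ∑-distrib-+ (λ i → indicator (Pᵢ i x)) (λ i → #Pᵢ i xs) ⟨
    sum (λ i → indicator (Pᵢ i x) + #Pᵢ i xs)
      ≡⟨ sum-cong-≗ (λ i → length-filter-∷ (Pᵢ i) x xs) ⟨
    sum (λ i → #Pᵢ i (x ∷ xs))
      ∎
    where
    open ≡-Reasoning
    Pᵢ : ∀ i → Decidable (λ y → P y × c y ≡ i)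
    Pᵢ i y = P? y ×-dec c y Fin.≟ i
    #Pᵢ : Fin r → List A → ℕ
    #Pᵢ i ys = length (filter (Pᵢ i) ys)
    split-head : ∀ b → (if b then 1 else 0) ≡ sum (λ i → if b ∧ does (c x Fin.≟ i) then 1 else 0)
    split-head true  = sym (∑-indicator (c x))
    split-head false = sym (sum-replicate-zero r)

-- Congruence modulo m

module Mod (m : ℕ) .{{_ : NonZero m}} where

  -- A record rather than the equation a % m ≡ b % m itself, so that a and b can be inferred.
  infix 4 _≈_
  record _≈_ (a b : ℕ) : Set where
    constructor mk≈
    field %-≡ : a % m ≡ b % m
  open _≈_ public

  ≈-refl : ∀ {a} → a ≈ a
  ≈-refl = mk≈ refl

  ≈-sym : ∀ {a b} → a ≈ b → b ≈ a
  ≈-sym (mk≈ p) = mk≈ (sym p)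

  ≈-trans : ∀ {a b c} → a ≈ b → b ≈ c → a ≈ c
  ≈-trans (mk≈ p) (mk≈ q) = mk≈ (trans p q)

  ≈-setoid : Setoid _ _
  ≈-setoid = record
    { Carrier = ℕ ; _≈_ = _≈_
    ; isEquivalence = record { refl = ≈-refl ; sym = ≈-sym ; trans = ≈-trans } }

  module ≈-Reasoning = SetoidReasoning ≈-setoid

  ≡⇒≈ : ∀ {a b} → a ≡ b → a ≈ b
  ≡⇒≈ a≡b = mk≈ (cong (_% m) a≡b)

  +-cong : ∀ {a a′ b b′} → a ≈ a′ → b ≈ b′ → a + b ≈ a′ + b′
  +-cong {a} {a′} {b} {b′} (mk≈ a≈a′) (mk≈ b≈b′) = mk≈ (begin
    (a + b) % m             ≡⟨ %-distribˡ-+ a b m ⟩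
    (a % m + b % m) % m     ≡⟨ cong₂ (λ x y → (x + y) % m) a≈a′ b≈b′ ⟩
    (a′ % m + b′ % m) % m   ≡⟨ %-distribˡ-+ a′ b′ m ⟨
    (a′ + b′) % m           ∎)
    where open ≡-Reasoning

  %-≈ : ∀ a → a % m ≈ a
  %-≈ a = mk≈ (m%n%n≡m%n a m)

  +m-≈ : ∀ a → a + m ≈ a
  +m-≈ a = mk≈ ([m+n]%n≡m%n a m)

  <-≈⇒≡ : ∀ {a b} → a < m → b < m → a ≈ b → a ≡ b
  <-≈⇒≡ a<m b<m (mk≈ a≈b) = trans (sym (m<n⇒m%n≡m a<m)) (trans a≈b (m<n⇒m%n≡m b<m))

  -- Reducing first makes neg a an additive inverse of a also when a > m.
  neg : ℕ → ℕ
  neg a = m ∸ a % m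

  neg-cong : ∀ {a b} → a ≈ b → neg a ≡ neg b
  neg-cong (mk≈ a≈b) = cong (m ∸_) a≈b

  neg-inverse : ∀ a → neg a + a ≈ 0
  neg-inverse a = begin
    neg a + a         ≈⟨ +-cong ≈-refl (%-≈ a) ⟨
    neg a + a % m     ≡⟨ m∸n+n≡m (<⇒≤ (m%n<n a m)) ⟩
    m                 ≈⟨ mk≈ (trans (n%n≡0 m) (sym (m<n⇒m%n≡m (>-nonZero⁻¹ m)))) ⟩
    0                 ∎
    where open ≈-Reasoning

  +-cancelʳ : ∀ {a b} c → a + c ≈ b + c → a ≈ b
  +-cancelʳ {a} {b} c eq = begin
    a                 ≡⟨ +-identityʳ a ⟨
    a + 0             ≈⟨ +-cong ≈-refl (neg-inverse c) ⟨
    a + (neg c + c)   ≡⟨ shuffle a (neg c) c ⟩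
    (a + c) + neg c   ≈⟨ +-cong eq ≈-refl ⟩
    (b + c) + neg c   ≡⟨ shuffle b (neg c) c ⟨
    b + (neg c + c)   ≈⟨ +-cong ≈-refl (neg-inverse c) ⟩
    b + 0             ≡⟨ +-identityʳ b ⟩
    b                 ∎
    where
    open ≈-Reasoning
    shuffle : ∀ x y z → x + (y + z) ≡ (x + z) + y
    shuffle x y z = solve (x ∷ y ∷ z ∷ [])

  neg-unique : ∀ {a b} → a + b ≈ 0 → neg b ≈ a
  neg-unique {a} {b} a+b≈0 = +-cancelʳ b (≈-trans (neg-inverse b) (≈-sym a+b≈0))

  neg-+ : ∀ a b → neg (a + b) ≈ neg a + neg b
  neg-+ a b = neg-unique (begin
    neg a + neg b + (a + b)    ≡⟨ shuffle (neg a) (neg b) a b ⟩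
    (neg a + a) + (neg b + b)  ≈⟨ +-cong (neg-inverse a) (neg-inverse b) ⟩
    0                          ∎)
    where
    open ≈-Reasoning
    shuffle : ∀ w x y z → w + x + (y + z) ≡ (w + y) + (x + z)
    shuffle w x y z = solve (w ∷ x ∷ y ∷ z ∷ [])

  neg-neg : ∀ a → neg (neg a) ≈ a
  neg-neg a = neg-unique (≈-trans (≡⇒≈ (+-comm a (neg a))) (neg-inverse a))

  ∣⇒%≡ : ∀ {d} .{{_ : NonZero d}} → d ∣ m → ∀ {a b} → a ≈ b → a % d ≡ b % d
  ∣⇒%≡ {d} d∣m {a} {b} (mk≈ a≈b) = begin
    a % d       ≡⟨ m∣n⇒o%n%m≡o%m d m a d∣m ⟨
    a % m % d   ≡⟨ cong (_% d) a≈b ⟩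
    b % m % d   ≡⟨ m∣n⇒o%n%m≡o%m d m b d∣m ⟩
    b % d       ∎
    where open ≡-Reasoning

-- The group law of the dihedral group

module DihedralGroup (k : ℕ) .{{_ : NonZero k}} where
  open Dihedral k
  open Mod n

  bit : G → Bool
  bit = proj₁

  exp : G → ℕ
  exp g = toℕ (proj₂ g)

  exp<n : ∀ g → exp g < n
  exp<n g = Fin.toℕ<n (proj₂ g)

  signed : Bool → ℕ → ℕ
  signed false a = a
  signed true  a = neg a

  signed-cong : ∀ d {a b} → a ≈ b → signed d a ≈ signed d b
  signed-cong false a≈b = a≈b
  signed-cong true  a≈b = ≡⇒≈ (neg-cong a≈b)

  signed-+ : ∀ d a b → signed d (a + b) ≈ signed d a + signed d b
  signed-+ false a b = ≈-refl
  signed-+ true  a b = neg-+ a b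

  signed-signed : ∀ d f a → signed d (signed f a) ≈ signed (f xor d) a
  signed-signed d     false a = ≈-refl
  signed-signed false true  a = ≈-refl
  signed-signed true  true  a = neg-neg a

  toℕ-md : ∀ a → toℕ (md a) ≡ a % n
  toℕ-md a = Fin.toℕ-fromℕ< (m%n<n a n)

  ≡-by-exp : ∀ {g h} → bit g ≡ bit h → exp g ≈ exp h → g ≡ h
  ≡-by-exp {b , a} {b , c} refl a≈c =
    cong (b ,_) (Fin.toℕ-injective (<-≈⇒≡ (exp<n (b , a)) (exp<n (b , c)) a≈c))

  exp-md : ∀ b a → exp (b , md a) ≈ a
  exp-md b a = ≈-trans (≡⇒≈ (toℕ-md a)) (%-≈ a)

  n∸exp : ∀ g → n ∸ exp g ≡ neg (exp g)
  n∸exp g = cong (n ∸_) (sym (m<n⇒m%n≡m (exp<n g)))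

  exp-· : ∀ g h → exp (g · h) ≈ signed (bit h) (exp g) + exp h
  exp-· (b , a) (false , c) = exp-md b (toℕ a + toℕ c)
  exp-· (b , a) (true  , c) = ≈-trans (exp-md b _) (≡⇒≈ (cong (_+ toℕ c) (n∸exp (b , a))))

  exp-inv : ∀ g → exp (inv g) ≈ signed (not (bit g)) (exp g)
  exp-inv (false , a) = ≈-trans (exp-md false _) (≡⇒≈ (n∸exp (false , a)))
  exp-inv (true  , a) = ≈-refl

  exp-e : exp e ≡ 0
  exp-e = trans (toℕ-md 0) (m<n⇒m%n≡m (>-nonZero⁻¹ n))

  ·-md : ∀ {b a d c f e} → b xor d ≡ f → signed d a + c ≈ e → (b , md a) · (d , md c) ≡ (f , md e)
  ·-md {b} {a} {d} {c} {f} {e} bits exps = ≡-by-exp bits (begin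
    exp ((b , md a) · (d , md c))                  ≈⟨ exp-· (b , md a) (d , md c) ⟩
    signed d (exp (b , md a)) + exp (d , md c)     ≈⟨ +-cong (signed-cong d (exp-md b a)) (exp-md d c) ⟩
    signed d a + c                                 ≈⟨ exps ⟩
    e                                              ≈⟨ exp-md f e ⟨
    exp (f , md e)                                 ∎)
    where open ≈-Reasoning

  ≡-md : ∀ {b a c} → toℕ a ≈ c → (b , a) ≡ (b , md c)
  ≡-md {b} {a} {c} a≈c = ≡-by-exp refl (≈-trans a≈c (≈-sym (exp-md b c)))

  ·-assoc : ∀ g h l → (g · h) · l ≡ g · (h · l)
  ·-assoc g h l = ≡-by-exp (xor-assoc (bit g) (bit h) (bit l)) (begin
    exp ((g · h) · l)                                        ≈⟨ exp-· (g · h) l ⟩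
    signed (bit l) (exp (g · h)) + exp l                     ≈⟨ +-cong (signed-cong (bit l) (exp-· g h)) ≈-refl ⟩
    signed (bit l) (signed (bit h) (exp g) + exp h) + exp l  ≈⟨ +-cong (signed-+ (bit l) _ _) ≈-refl ⟩
    signed (bit l) (signed (bit h) (exp g)) + signed (bit l) (exp h) + exp l
                          ≡⟨ +-assoc (signed (bit l) (signed (bit h) (exp g))) (signed (bit l) (exp h)) (exp l) ⟩
    signed (bit l) (signed (bit h) (exp g)) + (signed (bit l) (exp h) + exp l)
                          ≈⟨ +-cong (≈-sym (signed-signed (bit l) (bit h) (exp g))) (exp-· h l) ⟨
    signed (bit (h · l)) (exp g) + exp (h · l)               ≈⟨ exp-· g (h · l) ⟨
    exp (g · (h · l))                                        ∎)
    where open ≈-Reasoning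

  ·-identityˡ : ∀ g → e · g ≡ g
  ·-identityˡ g = ≡-by-exp refl (begin
    exp (e · g)                      ≈⟨ exp-· e g ⟩
    signed (bit g) (exp e) + exp g   ≈⟨ +-cong (signed-cong (bit g) (≡⇒≈ exp-e)) ≈-refl ⟩
    signed (bit g) 0 + exp g         ≈⟨ +-cong (zero-signed (bit g)) ≈-refl ⟩
    exp g                            ∎)
    where
    open ≈-Reasoning
    zero-signed : ∀ d → signed d 0 ≈ 0
    zero-signed false = ≈-refl
    zero-signed true  = ≈-trans (≡⇒≈ (sym (+-identityʳ (neg 0)))) (neg-inverse 0)

  ·-identityʳ : ∀ g → g · e ≡ g
  ·-identityʳ g = ≡-by-exp (xor-identityʳ (bit g)) (begin
    exp (g · e)         ≈⟨ exp-· g e ⟩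
    exp g + exp e       ≡⟨ cong (exp g +_) exp-e ⟩
    exp g + 0           ≡⟨ +-identityʳ (exp g) ⟩
    exp g               ∎)
    where open ≈-Reasoning

  inv-inverseˡ : ∀ g → inv g · g ≡ e
  inv-inverseˡ g = ≡-by-exp (bit-inv g) (≈-trans (exp-· (inv g) g) (≈-trans (inverse g) (≡⇒≈ (sym exp-e))))
    where
    bit-inv : ∀ g → bit (inv g · g) ≡ bit e
    bit-inv (false , a) = refl
    bit-inv (true  , a) = refl
    inverse : ∀ g → signed (bit g) (exp (inv g)) + exp g ≈ 0
    inverse (false , a) = ≈-trans (+-cong (exp-inv (false , a)) ≈-refl) (neg-inverse (toℕ a))
    inverse (true  , a) = neg-inverse (toℕ a)

  inv-inverseʳ : ∀ g → g · inv g ≡ e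
  inv-inverseʳ g = ≡-by-exp (bit-inv g) (≈-trans (exp-· g (inv g)) (≈-trans (inverse g) (≡⇒≈ (sym exp-e))))
    where
    bit-inv : ∀ g → bit (g · inv g) ≡ bit e
    bit-inv (false , a) = refl
    bit-inv (true  , a) = refl
    inverse : ∀ g → signed (bit (inv g)) (exp g) + exp (inv g) ≈ 0
    inverse (false , a) = ≈-trans (+-cong ≈-refl (exp-inv (false , a)))
                                (≈-trans (≡⇒≈ (+-comm (toℕ a) _)) (neg-inverse (toℕ a)))
    inverse (true  , a) = neg-inverse (toℕ a)

  dihedral : Group 0ℓ 0ℓ
  dihedral = record
    { Carrier = G ; _≈_ = _≡_ ; _∙_ = _·_ ; ε = e ; _⁻¹ = inv
    ; isGroup = record
      { isMonoid = record
        { isSemigroup = record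
          { isMagma = record { isEquivalence = isEquivalence ; ∙-cong = cong₂ _·_ }
          ; assoc = ·-assoc }
        ; identity = ·-identityˡ , ·-identityʳ }
      ; inverse = inv-inverseˡ , inv-inverseʳ
      ; ⁻¹-cong = cong inv } }

  elems-unique : Unique elems
  elems-unique = Unique.cartesianProduct⁺ bits-unique (Unique.allFin⁺ n)
    where
    bits-unique : Unique (false ∷ true ∷ [])
    bits-unique = ((λ ()) All.∷ All.[]) AllPairs.∷ All.[] AllPairs.∷ AllPairs.[]

  elems-complete : ∀ g → g ∈ elems
  elems-complete (false , a) = ∈-cartesianProduct⁺ {xs = false ∷ true ∷ []} (here refl) (∈-allFin a)
  elems-complete (true  , a) = ∈-cartesianProduct⁺ {xs = false ∷ true ∷ []} (there (here refl)) (∈-allFin a)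

  pairs-unique : Unique pairs
  pairs-unique = Unique.cartesianProduct⁺ elems-unique elems-unique

  pairs-complete : ∀ p → p ∈ pairs
  pairs-complete (g , h) = ∈-cartesianProduct⁺ (elems-complete g) (elems-complete h)

  _≟P_ : DecidableEquality (G × G)
  _≟P_ = ≡-dec _≟G_ _≟G_

  central : ∀ r → bit r ≡ false → exp r + exp r ≈ 0 → ∀ g → r · g ≡ g · r
  central (false , c) refl r²≈0 g = ≡-by-exp (sym (xor-identityʳ (bit g))) (begin
    exp ((false , c) · g)                   ≈⟨ exp-· (false , c) g ⟩
    signed (bit g) (toℕ c) + exp g          ≈⟨ +-cong (self-inverse (bit g)) ≈-refl ⟩
    toℕ c + exp g                           ≡⟨ +-comm (toℕ c) (exp g) ⟩
    exp g + toℕ c                           ≈⟨ exp-· g (false , c) ⟨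
    exp (g · (false , c))                   ∎)
    where
    open ≈-Reasoning
    self-inverse : ∀ b → signed b (toℕ c) ≈ toℕ c
    self-inverse false = ≈-refl
    self-inverse true  = neg-unique r²≈0

  module Residues (d : ℕ) .{{_ : NonZero d}} (d∣n : d ∣ n) where
    private module D = Mod d

    res : G → ℕ
    res g = exp g % d

    combine : Bool → ℕ → ℕ → ℕ
    combine false α β = (α + β) % d
    combine true  α β = (D.neg α + β) % d

    res-≈ : ∀ {a b} → a ≈ b → a % d ≡ b % d
    res-≈ = ∣⇒%≡ d∣n

    res-· : ∀ g h → res (g · h) ≡ combine (bit h) (res g) (res h)
    res-· g h = trans (res-≈ (exp-· g h)) (combine-signed (bit h))
      where
      neg≈neg : neg (exp g) D.≈ D.neg (exp g % d)
      neg≈neg = D.≈-trans (D.≈-sym (D.neg-unique (D.mk≈ (res-≈ (neg-inverse (exp g))))))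
                          (D.≡⇒≈ (D.neg-cong (D.≈-sym (D.%-≈ (exp g)))))
      combine-signed : ∀ b → (signed b (exp g) + exp h) % d ≡ combine b (res g) (res h)
      combine-signed false = %-distribˡ-+ (exp g) (exp h) d
      combine-signed true  = D.%-≡ (D.+-cong neg≈neg (D.≈-sym (D.%-≈ (exp h))))

-- S-rings over the dihedral group

module SRingProperties (k : ℕ) .{{_ : NonZero k}} {r : ℕ}
  (d : Dihedral.G k → Fin r) (d-SRing : Dihedral.IsSRing k d) where
  open Dihedral k
  open DihedralGroup k
  open Algebra.Properties.Group dihedral using (\\-leftDividesˡ; \\-leftDividesʳ)
  open Counting _≟P_

  private
    d-surjective = proj₁ d-SRing
    d-count = proj₂ (proj₂ (proj₂ d-SRing))

  factorisation-lift : ∀ {z z′ a b} → d z ≡ d z′ → a · b ≡ z →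
    ∃ λ a′ → ∃ λ b′ → d a′ ≡ d a × d b′ ≡ d b × a′ · b′ ≡ z′
  factorisation-lift {z} {z′} {a} {b} dz≡dz′ ab≡z
    with length-filter>0⇒∃ _ pairs (subst (0 <_) (d-count (d a) (d b) z z′ dz≡dz′) count-pos)
    where
    count-pos : 0 < count d (d a) (d b) z
    count-pos = filter-some _ (lose (pairs-complete (a , b)) ((refl , refl) , ab≡z))
  ... | (a′ , b′) , _ , (da′ , db′) , a′b′≡z′ = a′ , b′ , da′ , db′ , a′b′≡z′

  Singleton : G → Set
  Singleton t = ∀ g → d g ≡ d t → g ≡ t

  singleton-· : ∀ {a b} → Singleton a → Singleton b → Singleton (a · b)
  singleton-· {a} {b} a! b! z dz≡dab with factorisation-lift (sym dz≡dab) refl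
  ... | a′ , b′ , da′ , db′ , a′b′≡z = trans (sym a′b′≡z) (cong₂ _·_ (a! a′ da′) (b! b′ db′))

  translate : ∀ {t g h} → Singleton t → d g ≡ d h → d (inv t · g) ≡ d (inv t · h)
  translate {t} {g} {h} t! dg≡dh with factorisation-lift dg≡dh (\\-leftDividesˡ t g)
  ... | t′ , b′ , dt′ , db′ , t′b′≡h rewrite t! t′ dt′ =
    trans (sym db′) (cong d (trans (sym (\\-leftDividesʳ t b′)) (cong (inv t ·_) t′b′≡h)))

  module _ (S : G → Bool) (S-union : UnionOfBasic S d) where

    InS·S : G → G × G → Set
    InS·S z (a , b) = (S a ≡ true × S b ≡ true) × a · b ≡ z

    inS·S? : ∀ z → Decidable (InS·S z)
    inS·S? z (a , b) = (S a Bool.≟ true ×-dec S b Bool.≟ true) ×-dec (a · b) ≟G z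

    #S·S : G → ℕ
    #S·S z = length (filter (inS·S? z) pairs)

    private
      S̄ : Fin r → Bool
      S̄ i = S (proj₁ (d-surjective i))

      S-on-class : ∀ {a i} → d a ≡ i → S a ≡ S̄ i
      S-on-class {a} {i} da≡i = S-union a _ (trans da≡i (sym (proj₂ (d-surjective i))))

      InClasses : Fin r → Fin r → G → G × G → Set
      InClasses i j z p = (InS·S z p × d (proj₁ p) ≡ i) × d (proj₂ p) ≡ j

      inClasses? : ∀ i j z → Decidable (InClasses i j z)
      inClasses? i j z p = (inS·S? z p ×-dec d (proj₁ p) Fin.≟ i) ×-dec d (proj₂ p) Fin.≟ j

      #InClasses : ∀ i j z → length (filter (inClasses? i j z) pairs)
                             ≡ (if S̄ i ∧ S̄ j then count d i j z else 0)
      #InClasses i j z with S̄ i in S̄i | S̄ j in S̄j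
      ... | true | true = cong length (filter-≐ (inClasses? i j z) _ (forget , remember) pairs)
        where
        forget : ∀ {p} → InClasses i j z p → (d (proj₁ p) ≡ i × d (proj₂ p) ≡ j) × proj₁ p · proj₂ p ≡ z
        forget ((((_ , _) , ab≡z) , da≡i) , db≡j) = (da≡i , db≡j) , ab≡z
        remember : ∀ {p} → (d (proj₁ p) ≡ i × d (proj₂ p) ≡ j) × proj₁ p · proj₂ p ≡ z → InClasses i j z p
        remember ((da≡i , db≡j) , ab≡z) =
          (((trans (S-on-class da≡i) S̄i , trans (S-on-class db≡j) S̄j) , ab≡z) , da≡i) , db≡j
      ... | false | _ = cong length (filter-none (inClasses? i j z) {xs = pairs} (All.tabulate λ {p} _ → outside-i p))
        where
        outside-i : ∀ p → ¬ InClasses i j z p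
        outside-i p ((((Sa , _) , _) , da≡i) , _) = true≢false (trans (sym Sa) (trans (S-on-class da≡i) S̄i))
      ... | true | false = cong length (filter-none (inClasses? i j z) {xs = pairs} (All.tabulate λ {p} _ → outside-j p))
        where
        outside-j : ∀ p → ¬ InClasses i j z p
        outside-j p ((((_ , Sb) , _) , _) , db≡j) = true≢false (trans (sym Sb) (trans (S-on-class db≡j) S̄j))

    #S·S-constant : ∀ {z z′} → d z ≡ d z′ → #S·S z ≡ #S·S z′
    #S·S-constant {z} {z′} dz≡dz′ = begin
      #S·S z    ≡⟨ split z ⟩
      sum (λ i → sum (λ j → length (filter (inClasses? i j z) pairs)))
        ≡⟨ sum-cong-≗ (λ i → sum-cong-≗ (λ j → class-pair-constant i j)) ⟩
      sum (λ i → sum (λ j → length (filter (inClasses? i j z′) pairs)))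
        ≡⟨ split z′ ⟨
      #S·S z′   ∎
      where
      open ≡-Reasoning
      split : ∀ z → #S·S z ≡ sum (λ i → sum (λ j → length (filter (inClasses? i j z) pairs)))
      split z = trans (length-filter-∑ (inS·S? z) (d ∘ proj₁) pairs)
        (sum-cong-≗ λ i → length-filter-∑ (λ p → inS·S? z p ×-dec d (proj₁ p) Fin.≟ i) (d ∘ proj₂) pairs)
      class-pair-constant : ∀ i j → length (filter (inClasses? i j z) pairs) ≡ length (filter (inClasses? i j z′) pairs)
      class-pair-constant i j = trans (#InClasses i j z)
        (trans (cong (if S̄ i ∧ S̄ j then_else 0) (d-count i j z z′ dz≡dz′)) (sym (#InClasses i j z′)))

-- Orbit partitions of involutive automorphisms

module InvolutiveAutomorphism (k : ℕ) .{{_ : NonZero k}} (ψ : Dihedral.G k → Dihedral.G k)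
  (ψ-· : ∀ a b → ψ (Dihedral._·_ k a b) ≡ Dihedral._·_ k (ψ a) (ψ b))
  (ψ-involutive : ∀ g → ψ (ψ g) ≡ g) where
  open Dihedral k
  open DihedralGroup k
  open Algebra.Properties.Group dihedral using (identityˡ-unique; inverseʳ-unique)
  open Counting _≟P_

  ψ-injective : ∀ {g h} → ψ g ≡ ψ h → g ≡ h
  ψ-injective {g} {h} ψg≡ψh = trans (sym (ψ-involutive g)) (trans (cong ψ ψg≡ψh) (ψ-involutive h))

  ψ-e : ψ e ≡ e
  ψ-e = identityˡ-unique (ψ e) (ψ e) (trans (sym (ψ-· e e)) (cong ψ (·-identityˡ e)))

  ψ-inv : ∀ g → ψ (inv g) ≡ inv (ψ g)
  ψ-inv g = inverseʳ-unique (ψ g) (ψ (inv g)) (trans (sym (ψ-· g (inv g))) (trans (cong ψ (inv-inverseʳ g)) ψ-e))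

  count-ψ : ∀ {r} (c : G → Fin r) → (∀ g → c (ψ g) ≡ c g) → ∀ i j z → count c i j (ψ z) ≡ count c i j z
  count-ψ c c-ψ i j z = trans
    (length-filter-∘-involution pairs-unique pairs-complete _ ψ×ψ ψ×ψ-involutive)
    (cong length (filter-≐ _ _ (to , from) pairs))
    where
    ψ×ψ : G × G → G × G
    ψ×ψ (a , b) = ψ a , ψ b
    ψ×ψ-involutive : ∀ p → ψ×ψ (ψ×ψ p) ≡ p
    ψ×ψ-involutive (a , b) = cong₂ _,_ (ψ-involutive a) (ψ-involutive b)
    to : ∀ {p} → ((c (ψ (proj₁ p)) ≡ i × c (ψ (proj₂ p)) ≡ j) × ψ (proj₁ p) · ψ (proj₂ p) ≡ ψ z) →
         (c (proj₁ p) ≡ i × c (proj₂ p) ≡ j) × proj₁ p · proj₂ p ≡ z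
    to {a , b} ((ca , cb) , ψab) =
      (trans (sym (c-ψ a)) ca , trans (sym (c-ψ b)) cb) , ψ-injective (trans (ψ-· a b) ψab)
    from : ∀ {p} → (c (proj₁ p) ≡ i × c (proj₂ p) ≡ j) × proj₁ p · proj₂ p ≡ z →
           (c (ψ (proj₁ p)) ≡ i × c (ψ (proj₂ p)) ≡ j) × ψ (proj₁ p) · ψ (proj₂ p) ≡ ψ z
    from {a , b} ((ca , cb) , ab≡z) =
      (trans (c-ψ a) ca , trans (c-ψ b) cb) , trans (sym (ψ-· a b)) (cong ψ ab≡z)

  orbit-partition-SRing : ∀ {r} (c : G → Fin r) → (∀ i → ∃ λ g → c g ≡ i) → (∀ g → c (ψ g) ≡ c g) →
                          (∀ g h → c g ≡ c h → h ≡ g ⊎ h ≡ ψ g) → IsSRing c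
  orbit-partition-SRing c c-surjective c-ψ c-orbit =
    c-surjective , identity-class , inverse-closed , count-constant
    where
    identity-class : ∀ g → c g ≡ c e → g ≡ e
    identity-class g cg≡ce with c-orbit e g (sym cg≡ce)
    ... | inj₁ g≡e  = g≡e
    ... | inj₂ g≡ψe = trans g≡ψe ψ-e
    inverse-closed : ∀ g h → c g ≡ c h → c (inv g) ≡ c (inv h)
    inverse-closed g h cg≡ch with c-orbit g h cg≡ch
    ... | inj₁ refl = refl
    ... | inj₂ refl = trans (sym (c-ψ (inv g))) (cong c (ψ-inv g))
    count-constant : ∀ i j z z′ → c z ≡ c z′ → count c i j z ≡ count c i j z′
    count-constant i j z z′ cz≡cz′ with c-orbit z z′ cz≡cz′
    ... | inj₁ refl = refl
    ... | inj₂ refl = sym (count-ψ c c-ψ i j z)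

-- The set Z for odd k = 2q + 1 ≥ 3

module OddDihedral (k : ℕ) .{{_ : NonZero k}} (q : ℕ) (k≡1+2q : k ≡ 1 + q * 2) (q≢0 : q ≢ 0) where
  open Dihedral k
  open DihedralGroup k
  open Mod n
  open Algebra.Properties.Group dihedral using (\\-leftDividesʳ; //-rightDividesʳ; ε⁻¹≈ε)

  n≡ : n ≡ 4 + q * 8
  n≡ = trans (cong (4 *_) k≡1+2q) (solve (q ∷ []))

  2k≡ : 2 * k ≡ 2 + q * 4
  2k≡ = trans (cong (2 *_) k≡1+2q) (solve (q ∷ []))

  2k∸1≡ : 2 * k ∸ 1 ≡ 1 + q * 4
  2k∸1≡ = cong (_∸ 1) 2k≡

  2[k∸1]≡ : 2 * (k ∸ 1) ≡ q * 4
  2[k∸1]≡ = begin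
    2 * (k ∸ 1)   ≡⟨ cong (λ k → 2 * (k ∸ 1)) k≡1+2q ⟩
    2 * (q * 2)   ≡⟨ solve (q ∷ []) ⟩
    q * 4         ∎
    where open ≡-Reasoning

  n∸1≡ : n ∸ 1 ≡ 3 + q * 8
  n∸1≡ = cong (_∸ 1) n≡

  n∸2≡ : n ∸ 2 ≡ 2 + q * 8
  n∸2≡ = cong (_∸ 2) n≡

  4∣n : 4 ∣ n
  4∣n = divides k (*-comm 4 k)

  2∣n : 2 ∣ n
  2∣n = divides (2 * k) 4k≡2k*2
    where
    4k≡2k*2 : 4 * k ≡ 2 * k * 2
    4k≡2k*2 = solve (k ∷ [])

  open Residues 4 4∣n using () renaming (res to res₄; res-· to res₄-·; res-≈ to res₄-≈; combine to combine₄)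
  open Residues 2 2∣n using () renaming (res to parity; res-· to parity-·; res-≈ to parity-≈; combine to combine₂)

  ≈-by-n : ∀ {a b} → a ≡ b + (4 + q * 8) → a ≈ b
  ≈-by-n {a} {b} a≡b+n = ≈-trans (≡⇒≈ (trans a≡b+n (cong (b +_) (sym n≡)))) (+m-≈ b)

  neg-by-n : ∀ a b → b + a ≡ 4 + q * 8 → neg a ≈ b
  neg-by-n a b b+a≡n = neg-unique (≈-by-n (trans b+a≡n (sym (+-identityˡ (4 + q * 8)))))

  <n : ∀ c m → c < 4 → m ≤ 8 → c + q * m < n
  <n c m c<4 m≤8 = subst (c + q * m <_) (sym n≡) (+-mono-<-≤ c<4 (*-monoʳ-≤ q m≤8))

  q*4≢0 : q * 4 ≢ 0
  q*4≢0 = q≢0 ∘ m*n≡0⇒m≡0 q 4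

  q*8≢q*4 : q * 8 ≢ q * 4
  q*8≢q*4 q*8≡q*4 = q*4≢0 (+-cancelʳ-≡ (q * 4) (q * 4) 0 (trans q*4+q*4≡q*8 q*8≡q*4))
    where
    q*4+q*4≡q*8 : q * 4 + q * 4 ≡ q * 8
    q*4+q*4≡q*8 = solve (q ∷ [])

  -- Each element is named after its normal form y^b x^a, with a reduced modulo n = 8q + 4.
  y x x² x⁻¹ x⁻² yx⁻³ yx⁻⁴ yx⁻² x²ᵏ yx²ᵏ yx²ᵏ⁻¹ yx⁻¹ x²ᵏ⁺¹ yx²⁽ᵏ⁻¹⁾ : G
  y      = true  , md 0
  x      = false , md 1
  x²     = false , md 2
  x⁻¹    = false , md (3 + q * 8)
  x⁻²    = false , md (2 + q * 8)
  yx⁻³   = true  , md (1 + q * 8)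
  yx⁻⁴   = true  , md (q * 8)
  yx⁻²   = true  , md (2 + q * 8)
  x²ᵏ    = false , md (2 + q * 4)
  yx²ᵏ   = true  , md (2 + q * 4)
  yx²ᵏ⁻¹ = true  , md (1 + q * 4)
  yx⁻¹   = true  , md (3 + q * 8)
  x²ᵏ⁺¹  = false , md (3 + q * 4)
  yx²⁽ᵏ⁻¹⁾ = true  , md (q * 4)

  toℕ-md< : ∀ {a} → a < n → toℕ (md a) ≡ a
  toℕ-md< a<n = trans (toℕ-md _) (m<n⇒m%n≡m a<n)

  %4-q4 : ∀ c → (c + q * 4) % 4 ≡ c % 4
  %4-q4 c = [m+kn]%n≡m%n c q 4

  %4-q8 : ∀ c → (c + q * 8) % 4 ≡ c % 4
  %4-q8 c = trans (cong (λ t → (c + t) % 4) (sym (*-assoc q 2 4))) ([m+kn]%n≡m%n c (q * 2) 4)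

  res₄-md : ∀ b a → res₄ (b , md a) ≡ a % 4
  res₄-md b a = res₄-≈ (exp-md b a)

  Z-rotation : ∀ a → Z (false , a) ≡ true → toℕ a % 4 ≡ 2
  Z-rotation a = ≡ᵇ-true⇒≡

  Z-rotation⁺ : ∀ a → toℕ a % 4 ≡ 2 → Z (false , a) ≡ true
  Z-rotation⁺ a = ≡⇒≡ᵇ-true

  Z-rotation⁻ : ∀ a → toℕ a % 4 ≢ 2 → Z (false , a) ≡ false
  Z-rotation⁻ a = ≢⇒≡ᵇ-false

  Z-reflection : ∀ a → Z (true , a) ≡ ((toℕ a % 4 ≡ᵇ 0) ∧ not (toℕ a ≡ᵇ q * 4)) ∨ (toℕ a ≡ᵇ 1 + q * 4)
                                      ∨ (toℕ a ≡ᵇ 2 + q * 8) ∨ (toℕ a ≡ᵇ 3 + q * 8)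
  Z-reflection a rewrite sym 2k∸1≡ | sym 2[k∸1]≡ | sym n∸1≡ | sym n∸2≡ = refl

  data ReflectionInZ (a : ℕ) : Set where
    in-yA₁     : a % 4 ≡ 0 → a ≢ q * 4 → ReflectionInZ a
    is-yx²ᵏ⁻¹  : a ≡ 1 + q * 4 → ReflectionInZ a
    is-yx⁻²    : a ≡ 2 + q * 8 → ReflectionInZ a
    is-yx⁻¹    : a ≡ 3 + q * 8 → ReflectionInZ a

  reflection-in-Z : ∀ a → Z (true , a) ≡ true → ReflectionInZ (toℕ a)
  reflection-in-Z a Za = view (trans (sym (Z-reflection a)) Za)
    where
    view : ((toℕ a % 4 ≡ᵇ 0) ∧ not (toℕ a ≡ᵇ q * 4)) ∨ (toℕ a ≡ᵇ 1 + q * 4)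
             ∨ (toℕ a ≡ᵇ 2 + q * 8) ∨ (toℕ a ≡ᵇ 3 + q * 8) ≡ true → ReflectionInZ (toℕ a)
    view Za with toℕ a % 4 ≡ᵇ 0 in r₀ | toℕ a ≡ᵇ q * 4 in e₀ | toℕ a ≡ᵇ 1 + q * 4 in e₁
               | toℕ a ≡ᵇ 2 + q * 8 in e₂ | toℕ a ≡ᵇ 3 + q * 8 in e₃
    ... | true  | false | _     | _     | _     =
      in-yA₁ (≡ᵇ-true⇒≡ r₀) (λ eq → true≢false (trans (sym (≡⇒≡ᵇ-true eq)) e₀))
    ... | _     | _     | true  | _     | _     = is-yx²ᵏ⁻¹ (≡ᵇ-true⇒≡ e₁)
    ... | _     | _     | _     | true  | _     = is-yx⁻² (≡ᵇ-true⇒≡ e₂)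
    ... | _     | _     | _     | _     | true  = is-yx⁻¹ (≡ᵇ-true⇒≡ e₃)
    ... | false | _     | false | false | false = ⊥-elim (true≢false (sym Za))
    ... | true  | true  | false | false | false = ⊥-elim (true≢false (sym Za))

  reflection-in-Z⁻ : ∀ a → ReflectionInZ (toℕ a) → Z (true , a) ≡ true
  reflection-in-Z⁻ a v = trans (Z-reflection a) (unview v)
    where
    unview : ReflectionInZ (toℕ a) → ((toℕ a % 4 ≡ᵇ 0) ∧ not (toℕ a ≡ᵇ q * 4)) ∨ (toℕ a ≡ᵇ 1 + q * 4)
                                      ∨ (toℕ a ≡ᵇ 2 + q * 8) ∨ (toℕ a ≡ᵇ 3 + q * 8) ≡ true
    unview (in-yA₁ r₀ e₀) rewrite ≡⇒≡ᵇ-true r₀ | ≢⇒≡ᵇ-false e₀ = refl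
    unview (is-yx²ᵏ⁻¹ e₁) rewrite ≡⇒≡ᵇ-true e₁ = ∨-zeroʳ _
    unview (is-yx⁻² e₂) rewrite ≡⇒≡ᵇ-true e₂ | ∨-zeroʳ (toℕ a ≡ᵇ 1 + q * 4) = ∨-zeroʳ _
    unview (is-yx⁻¹ e₃) rewrite ≡⇒≡ᵇ-true e₃ | ∨-zeroʳ (toℕ a ≡ᵇ 2 + q * 8)
                              | ∨-zeroʳ (toℕ a ≡ᵇ 1 + q * 4) = ∨-zeroʳ _

  reflection-in-Z₀ : ∀ a → Z (true , a) ≡ true → toℕ a % 4 ≡ 0 → toℕ a ≢ q * 4
  reflection-in-Z₀ a Za r with reflection-in-Z a Za
  ... | in-yA₁ _ e₀ = e₀
  ... | is-yx²ᵏ⁻¹ e = case trans (sym r) (trans (cong (_% 4) e) (%4-q4 1)) of λ ()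
  ... | is-yx⁻² e   = case trans (sym r) (trans (cong (_% 4) e) (%4-q8 2)) of λ ()
  ... | is-yx⁻¹ e   = case trans (sym r) (trans (cong (_% 4) e) (%4-q8 3)) of λ ()

  reflection-in-Z₁ : ∀ a → Z (true , a) ≡ true → toℕ a % 4 ≡ 1 → (true , a) ≡ yx²ᵏ⁻¹
  reflection-in-Z₁ a Za r with reflection-in-Z a Za
  ... | in-yA₁ r₀ _ = case trans (sym r) r₀ of λ ()
  ... | is-yx²ᵏ⁻¹ e = ≡-md (≡⇒≈ e)
  ... | is-yx⁻² e   = case trans (sym r) (trans (cong (_% 4) e) (%4-q8 2)) of λ ()
  ... | is-yx⁻¹ e   = case trans (sym r) (trans (cong (_% 4) e) (%4-q8 3)) of λ ()

  reflection-in-Z₂ : ∀ a → Z (true , a) ≡ true → toℕ a % 4 ≡ 2 → (true , a) ≡ yx⁻²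
  reflection-in-Z₂ a Za r with reflection-in-Z a Za
  ... | in-yA₁ r₀ _ = case trans (sym r) r₀ of λ ()
  ... | is-yx²ᵏ⁻¹ e = case trans (sym r) (trans (cong (_% 4) e) (%4-q4 1)) of λ ()
  ... | is-yx⁻² e   = ≡-md (≡⇒≈ e)
  ... | is-yx⁻¹ e   = case trans (sym r) (trans (cong (_% 4) e) (%4-q8 3)) of λ ()

  reflection-in-Z₃ : ∀ a → Z (true , a) ≡ true → toℕ a % 4 ≡ 3 → (true , a) ≡ yx⁻¹
  reflection-in-Z₃ a Za r with reflection-in-Z a Za
  ... | in-yA₁ r₀ _ = case trans (sym r) r₀ of λ ()
  ... | is-yx²ᵏ⁻¹ e = case trans (sym r) (trans (cong (_% 4) e) (%4-q4 1)) of λ ()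
  ... | is-yx⁻² e   = case trans (sym r) (trans (cong (_% 4) e) (%4-q8 2)) of λ ()
  ... | is-yx⁻¹ e   = ≡-md (≡⇒≈ e)

  reflection-not-in-Z₀ : ∀ a → Z (true , a) ≡ false → toℕ a % 4 ≡ 0 → (true , a) ≡ yx²⁽ᵏ⁻¹⁾
  reflection-not-in-Z₀ a Za≡false r with toℕ a ≟ q * 4
  ... | yes a≡q*4 = ≡-md (≡⇒≈ a≡q*4)
  ... | no a≢q*4  = ⊥-elim (true≢false (trans (sym (reflection-in-Z⁻ a (in-yA₁ r a≢q*4))) Za≡false))

  data Residue₄ (a : ℕ) : Set where
    ≡0 : a % 4 ≡ 0 → Residue₄ a
    ≡1 : a % 4 ≡ 1 → Residue₄ a
    ≡2 : a % 4 ≡ 2 → Residue₄ a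
    ≡3 : a % 4 ≡ 3 → Residue₄ a

  residue₄ : ∀ a → Residue₄ a
  residue₄ a with a % 4 in eq | m%n<n a 4
  ... | 0 | _ = ≡0 eq
  ... | 1 | _ = ≡1 eq
  ... | 2 | _ = ≡2 eq
  ... | 3 | _ = ≡3 eq
  ... | suc (suc (suc (suc _))) | s≤s (s≤s (s≤s (s≤s ())))

  res₄-·-by : ∀ g h {α β} → res₄ g ≡ α → res₄ h ≡ β → res₄ (g · h) ≡ combine₄ (bit h) α β
  res₄-·-by g h refl refl = res₄-· g h

  res₄-q4 : ∀ b c → res₄ (b , md (c + q * 4)) ≡ c % 4
  res₄-q4 b c = trans (res₄-md b (c + q * 4)) (%4-q4 c)

  res₄-q8 : ∀ b c → res₄ (b , md (c + q * 8)) ≡ c % 4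
  res₄-q8 b c = trans (res₄-md b (c + q * 8)) (%4-q8 c)

  Z-yx⁻² : Z yx⁻² ≡ true
  Z-yx⁻² = reflection-in-Z⁻ (md (2 + q * 8)) (is-yx⁻² (toℕ-md< (<n 2 8 (s<s (s<s z<s)) ≤-refl)))

  Z-yx⁻¹ : Z yx⁻¹ ≡ true
  Z-yx⁻¹ = reflection-in-Z⁻ (md (3 + q * 8)) (is-yx⁻¹ (toℕ-md< (<n 3 8 ≤-refl ≤-refl)))

  Z-yx²ᵏ⁻¹ : Z yx²ᵏ⁻¹ ≡ true
  Z-yx²ᵏ⁻¹ = reflection-in-Z⁻ (md (1 + q * 4)) (is-yx²ᵏ⁻¹ (toℕ-md< (<n 1 4 (s<s z<s) (m≤m+n 4 4))))

  yx²ᵏ⁻¹·yx⁻¹ : yx²ᵏ⁻¹ · yx⁻¹ ≡ x²ᵏ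
  yx²ᵏ⁻¹·yx⁻¹ = ·-md refl (begin
    neg (1 + q * 4) + (3 + q * 8)   ≈⟨ +-cong (neg-by-n (1 + q * 4) (3 + q * 4) (solve (q ∷ [])))
                                                (≈-refl {3 + q * 8}) ⟩
    3 + q * 4 + (3 + q * 8)         ≈⟨ ≈-by-n (solve (q ∷ [])) ⟩
    2 + q * 4                       ∎)
    where open ≈-Reasoning

  yx⁻¹·yx²ᵏ⁻¹ : yx⁻¹ · yx²ᵏ⁻¹ ≡ x²ᵏ
  yx⁻¹·yx²ᵏ⁻¹ = ·-md refl (begin
    neg (3 + q * 8) + (1 + q * 4)   ≈⟨ +-cong (neg-by-n (3 + q * 8) 1 (solve (q ∷ []))) (≈-refl {1 + q * 4}) ⟩
    1 + (1 + q * 4)                 ∎)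
    where open ≈-Reasoning

  x²ᵏ·yx⁻² : x²ᵏ · yx⁻² ≡ yx²⁽ᵏ⁻¹⁾
  x²ᵏ·yx⁻² = ·-md {false} refl (begin
    neg (2 + q * 4) + (2 + q * 8)   ≈⟨ +-cong (neg-by-n (2 + q * 4) (2 + q * 4) (solve (q ∷ [])))
                                                (≈-refl {2 + q * 8}) ⟩
    2 + q * 4 + (2 + q * 8)         ≈⟨ ≈-by-n (solve (q ∷ [])) ⟩
    q * 4                           ∎)
    where open ≈-Reasoning

  yx⁻²·x²ᵏ : yx⁻² · x²ᵏ ≡ yx²⁽ᵏ⁻¹⁾
  yx⁻²·x²ᵏ = ·-md refl (begin
    2 + q * 8 + (2 + q * 4)         ≈⟨ ≈-by-n (solve (q ∷ [])) ⟩
    q * 4                           ∎)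
    where open ≈-Reasoning

  reflection-pivot : ℕ → G
  reflection-pivot 1 = yx⁻¹
  reflection-pivot 3 = yx²ᵏ⁻¹
  reflection-pivot _ = yx⁻²

  pivot : G → G
  pivot (true  , a) = reflection-pivot (toℕ a % 4)
  pivot (false , a) = if does ((false , a) ≟G x²ᵏ) then yx²ᵏ⁻¹ else yx⁻²

  pivot-x²ᵏ : pivot x²ᵏ ≡ yx²ᵏ⁻¹
  pivot-x²ᵏ = cong (if_then yx²ᵏ⁻¹ else yx⁻²) (dec-true (x²ᵏ ≟G x²ᵏ) refl)

  pivot-rotation : ∀ {a} → (false , a) ≢ x²ᵏ → pivot (false , a) ≡ yx⁻²
  pivot-rotation {a} a≢x²ᵏ = cong (if_then yx²ᵏ⁻¹ else yx⁻²) (dec-false ((false , a) ≟G x²ᵏ) a≢x²ᵏ)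

  reflection-residue : ∀ α β →
    res₄ (true , β) ≡ combine₄ false (res₄ (true , α)) (res₄ ((true , α) · (true , β)))
  reflection-residue α β = trans (cong res₄ (sym (\\-leftDividesʳ (true , α) (true , β))))
                                 (res₄-· (true , α) ((true , α) · (true , β)))

  exp-≡yx²⁽ᵏ⁻¹⁾ : ∀ {a} → (true , a) ≡ yx²⁽ᵏ⁻¹⁾ → toℕ a ≡ q * 4
  exp-≡yx²⁽ᵏ⁻¹⁾ eq = trans (cong exp eq) (toℕ-md< (<n 0 4 z<s (m≤m+n 4 4)))

  pivot-factor : ∀ a b → Z a ≡ true → Z b ≡ true → Z (a · b) ≡ true → a · b ≢ yx⁻² →
                 a ≡ pivot (a · b) ⊎ b ≡ pivot (a · b)
  pivot-factor (false , α) (false , β) Za Zb Zab _ =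
    case trans (sym (Z-rotation (proj₂ ab) Zab))
               (res₄-·-by (false , α) (false , β) (Z-rotation α Za) (Z-rotation β Zb)) of λ ()
    where ab = (false , α) · (false , β)
  pivot-factor (false , α) (true , β) Za Zb Zab ab≢yx⁻² = inj₂ (by-residue (residue₄ (toℕ β)))
    where
    ab = (false , α) · (true , β)
    res-ab : ∀ {ρ} → toℕ β % 4 ≡ ρ → res₄ ab ≡ combine₄ true 2 ρ
    res-ab = res₄-·-by (false , α) (true , β) (Z-rotation α Za)
    by-residue : Residue₄ (toℕ β) → (true , β) ≡ pivot ab
    by-residue (≡0 r) = ⊥-elim (ab≢yx⁻² (reflection-in-Z₂ (proj₂ ab) Zab (res-ab r)))
    by-residue (≡1 r) = trans (reflection-in-Z₁ β Zb r) (sym (cong reflection-pivot (res-ab r)))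
    by-residue (≡2 r) = trans (reflection-in-Z₂ β Zb r) (sym (cong reflection-pivot (res-ab r)))
    by-residue (≡3 r) = trans (reflection-in-Z₃ β Zb r) (sym (cong reflection-pivot (res-ab r)))
  pivot-factor (true , α) (false , β) Za Zb Zab ab≢yx⁻² = inj₁ (by-residue (residue₄ (toℕ α)))
    where
    ab = (true , α) · (false , β)
    res-ab : ∀ {ρ} → toℕ α % 4 ≡ ρ → res₄ ab ≡ combine₄ false ρ 2
    res-ab r = res₄-·-by (true , α) (false , β) r (Z-rotation β Zb)
    by-residue : Residue₄ (toℕ α) → (true , α) ≡ pivot ab
    by-residue (≡0 r) = ⊥-elim (ab≢yx⁻² (reflection-in-Z₂ (proj₂ ab) Zab (res-ab r)))
    by-residue (≡1 r) = trans (reflection-in-Z₁ α Za r) (sym (cong reflection-pivot (res-ab r)))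
    by-residue (≡2 r) = trans (reflection-in-Z₂ α Za r) (sym (cong reflection-pivot (res-ab r)))
    by-residue (≡3 r) = trans (reflection-in-Z₃ α Za r) (sym (cong reflection-pivot (res-ab r)))
  pivot-factor (true , α) (true , β) Za Zb Zab _ = by-residue (residue₄ (toℕ α))
    where
    open ≡-Reasoning
    ab = (true , α) · (true , β)
    res-b : ∀ {ρ} → toℕ α % 4 ≡ ρ → res₄ (true , β) ≡ combine₄ false ρ 2
    res-b r = trans (reflection-residue α β) (cong₂ (combine₄ false) r (Z-rotation (proj₂ ab) Zab))
    ab≡x²ᵏ : ∀ {a′ b′} → (true , α) ≡ a′ → (true , β) ≡ b′ → a′ · b′ ≡ x²ᵏ → ab ≡ x²ᵏ
    ab≡x²ᵏ refl refl a′b′≡x²ᵏ = a′b′≡x²ᵏ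
    by-residue : Residue₄ (toℕ α) → (true , α) ≡ pivot ab ⊎ (true , β) ≡ pivot ab
    by-residue (≡0 r) with ab ≟G x²ᵏ
    ... | yes ab≡x²ᵏ = ⊥-elim (reflection-in-Z₀ α Za r (exp-≡yx²⁽ᵏ⁻¹⁾ (begin
      (true , α)               ≡⟨ //-rightDividesʳ (true , β) (true , α) ⟨
      ab · (true , β)          ≡⟨ cong₂ _·_ ab≡x²ᵏ (reflection-in-Z₂ β Zb (res-b r)) ⟩
      x²ᵏ · yx⁻²               ≡⟨ x²ᵏ·yx⁻² ⟩
      yx²⁽ᵏ⁻¹⁾                 ∎)))
    ... | no ab≢x²ᵏ = inj₂ (trans (reflection-in-Z₂ β Zb (res-b r)) (sym (pivot-rotation ab≢x²ᵏ)))
    by-residue (≡1 r) = inj₁ (trans (reflection-in-Z₁ α Za r) (sym (trans (cong pivot ab≡) pivot-x²ᵏ)))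
      where ab≡ = ab≡x²ᵏ (reflection-in-Z₁ α Za r) (reflection-in-Z₃ β Zb (res-b r)) yx²ᵏ⁻¹·yx⁻¹
    by-residue (≡2 r) with ab ≟G x²ᵏ
    ... | yes ab≡x²ᵏ = ⊥-elim (reflection-in-Z₀ β Zb (res-b r) (exp-≡yx²⁽ᵏ⁻¹⁾ (begin
      (true , β)               ≡⟨ \\-leftDividesʳ (true , α) (true , β) ⟨
      (true , α) · ab          ≡⟨ cong₂ _·_ (reflection-in-Z₂ α Za r) ab≡x²ᵏ ⟩
      yx⁻² · x²ᵏ               ≡⟨ yx⁻²·x²ᵏ ⟩
      yx²⁽ᵏ⁻¹⁾                 ∎)))
    ... | no ab≢x²ᵏ = inj₁ (trans (reflection-in-Z₂ α Za r) (sym (pivot-rotation ab≢x²ᵏ)))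
    by-residue (≡3 r) = inj₂ (trans (reflection-in-Z₁ β Zb (res-b r)) (sym (trans (cong pivot ab≡) pivot-x²ᵏ)))
      where ab≡ = ab≡x²ᵏ (reflection-in-Z₃ α Za r) (reflection-in-Z₁ β Zb (res-b r)) yx⁻¹·yx²ᵏ⁻¹

  yx⁻²·yx⁻¹ : yx⁻² · yx⁻¹ ≡ x
  yx⁻²·yx⁻¹ = ·-md refl (begin
    neg (2 + q * 8) + (3 + q * 8)   ≈⟨ +-cong (neg-by-n (2 + q * 8) 2 (solve (q ∷ []))) (≈-refl {3 + q * 8}) ⟩
    2 + (3 + q * 8)                 ≈⟨ ≈-by-n (solve (q ∷ [])) ⟩
    1                               ∎)
    where open ≈-Reasoning

  yx⁻²·yx²ᵏ⁻¹ : yx⁻² · yx²ᵏ⁻¹ ≡ x²ᵏ⁺¹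
  yx⁻²·yx²ᵏ⁻¹ = ·-md refl (+-cong (neg-by-n (2 + q * 8) 2 (solve (q ∷ []))) (≈-refl {1 + q * 4}))

  yx⁻²·yx²⁽ᵏ⁻¹⁾ : yx⁻² · yx²⁽ᵏ⁻¹⁾ ≡ x²ᵏ
  yx⁻²·yx²⁽ᵏ⁻¹⁾ = ·-md refl (+-cong (neg-by-n (2 + q * 8) 2 (solve (q ∷ []))) (≈-refl {q * 4}))

  yx⁻²·x : yx⁻² · x ≡ yx⁻¹
  yx⁻²·x = ·-md refl (≡⇒≈ (+-comm (2 + q * 8) 1))

  inv-x : inv x ≡ x⁻¹
  inv-x = ≡-md (≈-trans (exp-inv x)
    (≈-trans (≡⇒≈ (neg-cong (exp-md false 1))) (neg-by-n 1 (3 + q * 8) (solve (q ∷ [])))))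

  yx⁻²·x⁻¹ : yx⁻² · inv x ≡ yx⁻³
  yx⁻²·x⁻¹ = trans (cong (yx⁻² ·_) inv-x) (·-md refl (≈-by-n {2 + q * 8 + (3 + q * 8)} (solve (q ∷ []))))

  yx²ᵏ⁻¹·x : yx²ᵏ⁻¹ · x ≡ yx²ᵏ
  yx²ᵏ⁻¹·x = ·-md refl (≡⇒≈ (+-comm (1 + q * 4) 1))

  yx⁻¹·x²ᵏ⁺¹ : yx⁻¹ · x²ᵏ⁺¹ ≡ yx²ᵏ
  yx⁻¹·x²ᵏ⁺¹ = ·-md refl (≈-by-n {3 + q * 8 + (3 + q * 4)} (solve (q ∷ [])))

  yx²ᵏ⁻¹·x²ᵏ⁺¹ : yx²ᵏ⁻¹ · x²ᵏ⁺¹ ≡ y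
  yx²ᵏ⁻¹·x²ᵏ⁺¹ = ·-md refl (≈-by-n {1 + q * 4 + (3 + q * 4)} (solve (q ∷ [])))

  yx⁻¹·x : yx⁻¹ · x ≡ y
  yx⁻¹·x = ·-md refl (≈-by-n {3 + q * 8 + 1} (solve (q ∷ [])))

  yx⁻²·y : yx⁻² · y ≡ x²
  yx⁻²·y = ·-md refl (+-cong (neg-by-n (2 + q * 8) 2 (solve (q ∷ []))) (≈-refl {0}))

  x²·y : x² · y ≡ yx⁻²
  x²·y = ·-md {false} refl (≈-trans (+-cong (neg-by-n 2 (2 + q * 8) (solve (q ∷ []))) (≈-refl {0}))
                                    (≡⇒≈ (+-identityʳ (2 + q * 8))))

  y·x⁻² : y · x⁻² ≡ yx⁻²
  y·x⁻² = ·-md refl ≈-refl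

  yx⁻⁴·x² : yx⁻⁴ · x² ≡ yx⁻²
  yx⁻⁴·x² = ·-md refl (≡⇒≈ (+-comm (q * 8) 2))

  yx²ᵏ⁻¹·x²ᵏ : yx²ᵏ⁻¹ · x²ᵏ ≡ yx⁻¹
  yx²ᵏ⁻¹·x²ᵏ = ·-md refl (≡⇒≈ {1 + q * 4 + (2 + q * 4)} (solve (q ∷ [])))

  yx⁻¹·x²ᵏ : yx⁻¹ · x²ᵏ ≡ yx²ᵏ⁻¹
  yx⁻¹·x²ᵏ = ·-md refl (≈-by-n {3 + q * 8 + (2 + q * 4)} (solve (q ∷ [])))

  md-injective : ∀ {b a c} → a < n → c < n → (b , md a) ≡ (b , md c) → a ≡ c
  md-injective a<n c<n eq = trans (sym (toℕ-md< a<n)) (trans (cong exp eq) (toℕ-md< c<n))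

  yx⁻¹≢yx⁻² : yx⁻¹ ≢ yx⁻²
  yx⁻¹≢yx⁻² eq =
    case +-cancelʳ-≡ (q * 8) 3 2 (md-injective (<n 3 8 ≤-refl ≤-refl) (<n 2 8 (s<s (s<s z<s)) ≤-refl) eq) of λ ()

  Z-x² : Z x² ≡ true
  Z-x² = Z-rotation⁺ (md 2) (res₄-md false 2)

  Z-x⁻² : Z x⁻² ≡ true
  Z-x⁻² = Z-rotation⁺ (md (2 + q * 8)) (res₄-q8 false 2)

  Z-y : Z y ≡ true
  Z-y = reflection-in-Z⁻ (md 0) (in-yA₁ (res₄-md true 0)
    (λ 0≡q*4 → q*4≢0 (trans (sym 0≡q*4) (toℕ-md< (>-nonZero⁻¹ n)))))

  Z-yx⁻⁴ : Z yx⁻⁴ ≡ true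
  Z-yx⁻⁴ = reflection-in-Z⁻ (md (q * 8)) (in-yA₁ (res₄-q8 true 0)
    (λ q*8≡q*4 → q*8≢q*4 (trans (sym (toℕ-md< (<n 0 8 z<s ≤-refl))) q*8≡q*4)))

  Z-x : Z x ≡ false
  Z-x = Z-rotation⁻ (md 1) (λ r → case trans (sym (res₄-md false 1)) r of λ ())

  Z-yx²ᵏ : Z yx²ᵏ ≡ false
  Z-yx²ᵏ = ¬-not λ Z-yx²ᵏ → q*8≢q*4 (+-cancelˡ-≡ 2 _ _ (sym (md-injective
    (<n 2 4 (s<s (s<s z<s)) (m≤m+n 4 4)) (<n 2 8 (s<s (s<s z<s)) ≤-refl)
    (reflection-in-Z₂ (md (2 + q * 4)) Z-yx²ᵏ (res₄-q4 true 2)))))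

  Z-yx⁻³ : Z yx⁻³ ≡ false
  Z-yx⁻³ = ¬-not λ Z-yx⁻³ → q*8≢q*4 (+-cancelˡ-≡ 1 _ _ (md-injective
    (<n 1 8 (s<s z<s) ≤-refl) (<n 1 4 (s<s z<s) (m≤m+n 4 4))
    (reflection-in-Z₁ (md (1 + q * 8)) Z-yx⁻³ (res₄-q8 true 1))))

  yx⁻²-cancel : ∀ {g h} → yx⁻² · g ≡ h → g ≡ yx⁻² · h
  yx⁻²-cancel {g} yx⁻²g≡h = trans (sym (\\-leftDividesʳ yx⁻² g)) (cong (yx⁻² ·_) yx⁻²g≡h)

  yx⁻¹-class-candidates : ∀ τ → Z τ ≡ true → Z (yx⁻² · τ) ≡ false → τ ≢ yx⁻² →
                          τ ≡ x²ᵏ ⊎ τ ≡ yx²ᵏ⁻¹ ⊎ τ ≡ yx⁻¹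
  yx⁻¹-class-candidates (false , t) Zτ Zyx⁻²τ _ = inj₁ (trans (yx⁻²-cancel yx⁻²τ≡) yx⁻²·yx²⁽ᵏ⁻¹⁾)
    where
    yx⁻²τ≡ = reflection-not-in-Z₀ (proj₂ (yx⁻² · (false , t))) Zyx⁻²τ
               (res₄-·-by yx⁻² (false , t) (res₄-q8 true 2) (Z-rotation t Zτ))
  yx⁻¹-class-candidates (true , t) Zτ Zyx⁻²τ τ≢yx⁻² = by-residue (residue₄ (toℕ t))
    where
    yx⁻²τ = yx⁻² · (true , t)
    by-residue : Residue₄ (toℕ t) → (true , t) ≡ x²ᵏ ⊎ (true , t) ≡ yx²ᵏ⁻¹ ⊎ (true , t) ≡ yx⁻¹
    by-residue (≡0 r) = ⊥-elim (true≢false (trans (sym (Z-rotation⁺ (proj₂ yx⁻²τ)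
                          (res₄-·-by yx⁻² (true , t) (res₄-q8 true 2) r))) Zyx⁻²τ))
    by-residue (≡1 r) = inj₂ (inj₁ (reflection-in-Z₁ t Zτ r))
    by-residue (≡2 r) = ⊥-elim (τ≢yx⁻² (reflection-in-Z₂ t Zτ r))
    by-residue (≡3 r) = inj₂ (inj₂ (reflection-in-Z₃ t Zτ r))

  x-class-candidates : ∀ g → Z g ≡ false → Z (yx⁻² · g) ≡ true → Z (yx⁻² · inv g) ≡ false →
                       g ≡ x ⊎ g ≡ x²ᵏ⁺¹
  x-class-candidates (true , t) _ Zyx⁻²g Zyx⁻²g⁻¹ = ⊥-elim (true≢false (trans (sym Zyx⁻²g) Zyx⁻²g⁻¹))
  x-class-candidates (false , t) Zg Zyx⁻²g Zyx⁻²g⁻¹ = by-residue (residue₄ (toℕ t))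
    where
    yx⁻²g = yx⁻² · (false , t)
    res-yx⁻²g : ∀ {ρ} → toℕ t % 4 ≡ ρ → res₄ yx⁻²g ≡ combine₄ false 2 ρ
    res-yx⁻²g = res₄-·-by yx⁻² (false , t) (res₄-q8 true 2)
    by-residue : Residue₄ (toℕ t) → (false , t) ≡ x ⊎ (false , t) ≡ x²ᵏ⁺¹
    by-residue (≡0 r) = ⊥-elim (true≢false (trans (sym Z-yx⁻²) (trans (cong Z yx⁻²≡) Zyx⁻²g⁻¹)))
      where
      g≡e : (false , t) ≡ e
      g≡e = trans (yx⁻²-cancel (reflection-in-Z₂ (proj₂ yx⁻²g) Zyx⁻²g (res-yx⁻²g r))) (inv-inverseˡ yx⁻²)
      yx⁻²≡ : yx⁻² ≡ yx⁻² · inv (false , t)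
      yx⁻²≡ = sym (trans (cong (λ h → yx⁻² · inv h) g≡e)
                         (trans (cong (yx⁻² ·_) ε⁻¹≈ε) (·-identityʳ yx⁻²)))
    by-residue (≡1 r) =
      inj₁ (trans (yx⁻²-cancel (reflection-in-Z₃ (proj₂ yx⁻²g) Zyx⁻²g (res-yx⁻²g r))) yx⁻²·yx⁻¹)
    by-residue (≡2 r) = ⊥-elim (true≢false (trans (sym (Z-rotation⁺ t r)) Zg))
    by-residue (≡3 r) =
      inj₂ (trans (yx⁻²-cancel (reflection-in-Z₁ (proj₂ yx⁻²g) Zyx⁻²g (res-yx⁻²g r))) yx⁻²·yx²ᵏ⁻¹)

  parity-cases : ∀ g → parity g ≡ 0 ⊎ parity g ≡ 1
  parity-cases g = %2-cases (exp g)

  parity-·′ : ∀ g h → parity (g · h) ≡ (parity g + parity h) % 2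
  parity-·′ g h = trans (parity-· g h) (by-bit (bit h) (parity-cases g))
    where
    by-bit : ∀ b → parity g ≡ 0 ⊎ parity g ≡ 1 → combine₂ b (parity g) (parity h) ≡ (parity g + parity h) % 2
    by-bit false _ = refl
    by-bit true (inj₁ even) rewrite even = trans (cong (_% 2) (+-comm 2 (parity h))) ([m+n]%n≡m%n (parity h) 2)
    by-bit true (inj₂ odd)  rewrite odd  = refl

  parity-x²ᵏ : parity x²ᵏ ≡ 0
  parity-x²ᵏ = trans (parity-≈ (exp-md false (2 + q * 4)))
    (trans (cong (λ t → (2 + t) % 2) (sym (*-assoc q 2 2))) ([m+kn]%n≡m%n 2 (q * 2) 2))

  parity-·x²ᵏ : ∀ g → parity (g · x²ᵏ) ≡ parity g
  parity-·x²ᵏ g = trans (parity-·′ g x²ᵏ) (trans (cong (λ t → (parity g + t) % 2) parity-x²ᵏ)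
    (trans (cong (_% 2) (+-identityʳ (parity g))) (m%n%n≡m%n (exp g) 2)))

  x²ᵏ-central : ∀ g → x²ᵏ · g ≡ g · x²ᵏ
  x²ᵏ-central = central x²ᵏ refl x²ᵏ²≈0
    where
    x²ᵏ²≈0 : exp x²ᵏ + exp x²ᵏ ≈ 0
    x²ᵏ²≈0 = ≈-trans (+-cong (exp-md false (2 + q * 4)) (exp-md false (2 + q * 4)))
                     (≈-by-n {2 + q * 4 + (2 + q * 4)} (solve (q ∷ [])))

  x²ᵏ·x²ᵏ : x²ᵏ · x²ᵏ ≡ e
  x²ᵏ·x²ᵏ = ·-md {false} refl (≈-by-n {2 + q * 4 + (2 + q * 4)} (solve (q ∷ [])))

  ψ : G → G
  ψ g = if parity g ≡ᵇ 1 then g · x²ᵏ else g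

  ψ-odd : ∀ g → parity g ≡ 1 → ψ g ≡ g · x²ᵏ
  ψ-odd g odd rewrite odd = refl

  ψ-even : ∀ g → parity g ≡ 0 → ψ g ≡ g
  ψ-even g even rewrite even = refl

  ·x²ᵏ-involutive : ∀ g → (g · x²ᵏ) · x²ᵏ ≡ g
  ·x²ᵏ-involutive g = begin
    (g · x²ᵏ) · x²ᵏ      ≡⟨ ·-assoc g x²ᵏ x²ᵏ ⟩
    g · (x²ᵏ · x²ᵏ)      ≡⟨ cong (g ·_) x²ᵏ·x²ᵏ ⟩
    g · e                ≡⟨ ·-identityʳ g ⟩
    g                    ∎
    where open ≡-Reasoning

  ψ-involutive : ∀ g → ψ (ψ g) ≡ g
  ψ-involutive g with parity-cases g
  ... | inj₁ even = trans (cong ψ (ψ-even g even)) (ψ-even g even)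
  ... | inj₂ odd  = begin
    ψ (ψ g)              ≡⟨ cong ψ (ψ-odd g odd) ⟩
    ψ (g · x²ᵏ)          ≡⟨ ψ-odd (g · x²ᵏ) (trans (parity-·x²ᵏ g) odd) ⟩
    (g · x²ᵏ) · x²ᵏ      ≡⟨ ·x²ᵏ-involutive g ⟩
    g                    ∎
    where open ≡-Reasoning

  ψ-· : ∀ a b → ψ (a · b) ≡ ψ a · ψ b
  ψ-· a b with parity-cases a | parity-cases b
  ... | inj₁ ea | inj₁ eb = begin
    ψ (a · b)            ≡⟨ ψ-even (a · b) (trans (parity-·′ a b) (cong₂ (λ s t → (s + t) % 2) ea eb)) ⟩
    a · b                ≡⟨ cong₂ _·_ (ψ-even a ea) (ψ-even b eb) ⟨
    ψ a · ψ b            ∎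
    where open ≡-Reasoning
  ... | inj₂ oa | inj₁ eb = begin
    ψ (a · b)            ≡⟨ ψ-odd (a · b) (trans (parity-·′ a b) (cong₂ (λ s t → (s + t) % 2) oa eb)) ⟩
    (a · b) · x²ᵏ        ≡⟨ ·-assoc a b x²ᵏ ⟩
    a · (b · x²ᵏ)        ≡⟨ cong (a ·_) (x²ᵏ-central b) ⟨
    a · (x²ᵏ · b)        ≡⟨ ·-assoc a x²ᵏ b ⟨
    (a · x²ᵏ) · b        ≡⟨ cong₂ _·_ (ψ-odd a oa) (ψ-even b eb) ⟨
    ψ a · ψ b            ∎
    where open ≡-Reasoning
  ... | inj₁ ea | inj₂ ob = begin
    ψ (a · b)            ≡⟨ ψ-odd (a · b) (trans (parity-·′ a b) (cong₂ (λ s t → (s + t) % 2) ea ob)) ⟩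
    (a · b) · x²ᵏ        ≡⟨ ·-assoc a b x²ᵏ ⟩
    a · (b · x²ᵏ)        ≡⟨ cong₂ _·_ (ψ-even a ea) (ψ-odd b ob) ⟨
    ψ a · ψ b            ∎
    where open ≡-Reasoning
  ... | inj₂ oa | inj₂ ob = begin
    ψ (a · b)                  ≡⟨ ψ-even (a · b) (trans (parity-·′ a b) (cong₂ (λ s t → (s + t) % 2) oa ob)) ⟩
    a · b                      ≡⟨ cong (a ·_) (·-identityʳ b) ⟨
    a · (b · e)                ≡⟨ cong (λ t → a · (b · t)) x²ᵏ·x²ᵏ ⟨
    a · (b · (x²ᵏ · x²ᵏ))      ≡⟨ cong (a ·_) (·-assoc b x²ᵏ x²ᵏ) ⟨
    a · ((b · x²ᵏ) · x²ᵏ)      ≡⟨ cong (a ·_) (x²ᵏ-central (b · x²ᵏ)) ⟨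
    a · (x²ᵏ · (b · x²ᵏ))      ≡⟨ ·-assoc a x²ᵏ (b · x²ᵏ) ⟨
    (a · x²ᵏ) · (b · x²ᵏ)      ≡⟨ cong₂ _·_ (ψ-odd a oa) (ψ-odd b ob) ⟨
    ψ a · ψ b                  ∎
    where open ≡-Reasoning

  parity-res₄ : ∀ g → parity g ≡ res₄ g % 2
  parity-res₄ g = sym (m∣n⇒o%n%m≡o%m 2 4 (exp g) (divides 2 refl))

  odd-in-Z : ∀ g → parity g ≡ 1 → Z g ≡ true → g ≡ yx²ᵏ⁻¹ ⊎ g ≡ yx⁻¹
  odd-in-Z (false , a) odd Zg =
    case trans (sym odd) (trans (parity-res₄ (false , a)) (cong (_% 2) (Z-rotation a Zg))) of λ ()
  odd-in-Z (true , a) odd Zg with residue₄ (toℕ a)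
  ... | ≡0 r = case trans (sym odd) (trans (parity-res₄ (true , a)) (cong (_% 2) r)) of λ ()
  ... | ≡1 r = inj₁ (reflection-in-Z₁ a Zg r)
  ... | ≡2 r = case trans (sym odd) (trans (parity-res₄ (true , a)) (cong (_% 2) r)) of λ ()
  ... | ≡3 r = inj₂ (reflection-in-Z₃ a Zg r)

  Z-·x²ᵏ : ∀ g → parity g ≡ 1 → Z g ≡ true → Z (g · x²ᵏ) ≡ true
  Z-·x²ᵏ g odd Zg with odd-in-Z g odd Zg
  ... | inj₁ refl = trans (cong Z yx²ᵏ⁻¹·x²ᵏ) Z-yx⁻¹
  ... | inj₂ refl = trans (cong Z yx⁻¹·x²ᵏ) Z-yx²ᵏ⁻¹

  Z-ψ : ∀ g → Z (ψ g) ≡ Z g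
  Z-ψ g with parity-cases g
  ... | inj₁ even = cong Z (ψ-even g even)
  ... | inj₂ odd  = trans (cong Z (ψ-odd g odd)) (⇔→≡ (mk⇔
    (λ Zgx²ᵏ → trans (cong Z (sym (·x²ᵏ-involutive g)))
                     (Z-·x²ᵏ (g · x²ᵏ) (trans (parity-·x²ᵏ g) odd) Zgx²ᵏ))
    (Z-·x²ᵏ g odd)))

  instance
    2k≢0 : NonZero (2 * k)
    2k≢0 = m*n≢0 2 k

  n≡2*2k : n ≡ 2 * (2 * k)
  n≡2*2k = 4k≡2*2k
    where
    4k≡2*2k : 4 * k ≡ 2 * (2 * k)
    4k≡2*2k = solve (k ∷ [])

  2k+k≡3k : 2 * k + k ≡ 3 * k
  2k+k≡3k = solve (k ∷ [])

  2k+2k≡n : 2 * k + 2 * k ≡ n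
  2k+2k≡n = 2k+2k≡4k
    where
    2k+2k≡4k : 2 * k + 2 * k ≡ 4 * k
    2k+2k≡4k = solve (k ∷ [])

  2∣2k : 2 ∣ 2 * k
  2∣2k = divides k (*-comm 2 k)

  2k∣n : 2 * k ∣ n
  2k∣n = divides 2 n≡2*2k

  exp-x²ᵏ : exp x²ᵏ ≡ 2 * k
  exp-x²ᵏ = trans (toℕ-md< (<n 2 4 (s<s (s<s z<s)) (m≤m+n 4 4))) (sym 2k≡)

  -- Even exponents a < n get the indices a / 2 < 2k; an odd a shares its index with a ± 2k.
  index : ℕ → ℕ
  index a = if a % 2 ≡ᵇ 0 then a / 2 else 2 * k + a % (2 * k) / 2

  index-even : ∀ a → a % 2 ≡ 0 → index a ≡ a / 2
  index-even a even rewrite even = refl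

  index-odd : ∀ a → a % 2 ≡ 1 → index a ≡ 2 * k + a % (2 * k) / 2
  index-odd a odd rewrite odd = refl

  half<2k : ∀ {a} → a < n → a / 2 < 2 * k
  half<2k {a} a<n = m<n*o⇒m/o<n (subst (a <_) (trans n≡2*2k (*-comm 2 (2 * k))) a<n)

  odd-half<k : ∀ a → a % (2 * k) / 2 < k
  odd-half<k a = m<n*o⇒m/o<n (subst (a % (2 * k) <_) (*-comm 2 k) (m%n<n a (2 * k)))

  index<3k : ∀ {a} → a < n → index a < 3 * k
  index<3k {a} a<n with %2-cases a
  ... | inj₁ even = subst (_< 3 * k) (sym (index-even a even))
                      (<-≤-trans (half<2k a<n) (*-monoˡ-≤ k {2} {3} (s≤s (s≤s z≤n))))
  ... | inj₂ odd  = subst₂ _<_ (sym (index-odd a odd)) 2k+k≡3k (+-monoʳ-< (2 * k) (odd-half<k a))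

  index-surjective : ∀ {j} → j < 3 * k → ∃ λ a → a < n × index a ≡ j
  index-surjective {j} j<3k with j <? 2 * k
  ... | yes j<2k = j * 2 , <n′ , trans (index-even (j * 2) (m*n%n≡0 j 2)) (m*n/n≡m j 2)
    where
    <n′ : j * 2 < n
    <n′ = subst (j * 2 <_) (trans (*-comm (2 * k) 2) (sym n≡2*2k)) (*-monoˡ-< 2 j<2k)
  ... | no j≮2k = 1 + t * 2 , <-≤-trans a<2k (subst (2 * k ≤_) (sym n≡2*2k) (m≤n*m (2 * k) 2)) , (begin
    index (1 + t * 2)                            ≡⟨ index-odd (1 + t * 2) ([m+kn]%n≡m%n 1 t 2) ⟩
    2 * k + (1 + t * 2) % (2 * k) / 2            ≡⟨ cong (λ r → 2 * k + r / 2) (m<n⇒m%n≡m a<2k) ⟩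
    2 * k + (1 + t * 2) / 2                      ≡⟨ cong (2 * k +_) (trans (+-distrib-/-∣ʳ 1 {t * 2} {2} (divides t refl))
                                                                            (m*n/n≡m t 2)) ⟩
    2 * k + t                                    ≡⟨ m+[n∸m]≡n (≮⇒≥ j≮2k) ⟩
    j                                            ∎)
    where
    open ≡-Reasoning
    t = j ∸ 2 * k
    t<k : t < k
    t<k = +-cancelˡ-< (2 * k) t k (subst₂ _<_ (sym (m+[n∸m]≡n (≮⇒≥ j≮2k))) (sym 2k+k≡3k) j<3k)
    a<2k : 1 + t * 2 < 2 * k
    a<2k = subst (1 + t * 2 <_) (*-comm k 2) (*-monoˡ-≤ 2 t<k)

  index-fibre : ∀ {a a′} → a < n → a′ < n → index a ≡ index a′ →
                a ≡ a′ ⊎ (a % 2 ≡ 1 × a′ ≈ a + 2 * k)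
  index-fibre {a} {a′} a<n a′<n eq with %2-cases a | %2-cases a′
  ... | inj₁ even | inj₁ even′ =
    inj₁ (/2-injective (trans even (sym even′)) (trans (sym (index-even a even)) (trans eq (index-even a′ even′))))
  ... | inj₁ even | inj₂ odd′ =
    ⊥-elim (<⇒≱ (half<2k a<n)
      (subst (2 * k ≤_) (sym (trans (sym (index-even a even)) (trans eq (index-odd a′ odd′)))) (m≤m+n (2 * k) _)))
  ... | inj₂ odd | inj₁ even′ =
    ⊥-elim (<⇒≱ (half<2k a′<n)
      (subst (2 * k ≤_) (trans (sym (index-odd a odd)) (trans eq (index-even a′ even′))) (m≤m+n (2 * k) _)))
  ... | inj₂ odd | inj₂ odd′
    with %-fibre (2 * k) (subst (a <_) n≡2*2k a<n) (subst (a′ <_) n≡2*2k a′<n) same-residue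
    where
    residue-parity : ∀ b → b % (2 * k) % 2 ≡ b % 2
    residue-parity b = m∣n⇒o%n%m≡o%m 2 (2 * k) b 2∣2k
    same-residue : a % (2 * k) ≡ a′ % (2 * k)
    same-residue = /2-injective (trans (residue-parity a) (trans odd (sym (trans (residue-parity a′) odd′))))
      (+-cancelˡ-≡ (2 * k) _ _ (trans (sym (index-odd a odd)) (trans eq (index-odd a′ odd′))))
  ...   | inj₁ a≡a′ = inj₁ a≡a′
  ...   | inj₂ (inj₁ a′≡a+2k) = inj₂ (odd , ≡⇒≈ a′≡a+2k)
  ...   | inj₂ (inj₂ a≡a′+2k) = inj₂ (odd , ≈-sym (begin
    a + 2 * k               ≡⟨ cong (_+ 2 * k) a≡a′+2k ⟩
    a′ + 2 * k + 2 * k      ≡⟨ +-assoc a′ (2 * k) (2 * k) ⟩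
    a′ + (2 * k + 2 * k)    ≡⟨ cong (a′ +_) 2k+2k≡n ⟩
    a′ + n                  ≈⟨ +m-≈ a′ ⟩
    a′                      ∎))
    where open ≈-Reasoning

  exp-·x²ᵏ : ∀ g → exp (g · x²ᵏ) ≈ exp g + 2 * k
  exp-·x²ᵏ g = ≈-trans (exp-· g x²ᵏ) (≡⇒≈ (cong (exp g +_) exp-x²ᵏ))

  index-·x²ᵏ : ∀ g → exp g % 2 ≡ 1 → index (exp (g · x²ᵏ)) ≡ index (exp g)
  index-·x²ᵏ g odd = begin
    index (exp (g · x²ᵏ))                        ≡⟨ index-odd _ (trans same-parity odd) ⟩
    2 * k + exp (g · x²ᵏ) % (2 * k) / 2          ≡⟨ cong (λ r → 2 * k + r / 2) same-residue ⟩
    2 * k + exp g % (2 * k) / 2                  ≡⟨ index-odd (exp g) odd ⟨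
    index (exp g)                                ∎
    where
    open ≡-Reasoning
    same-parity : exp (g · x²ᵏ) % 2 ≡ exp g % 2
    same-parity = trans (∣⇒%≡ 2∣n (exp-·x²ᵏ g))
      (trans (cong (λ t → (exp g + t) % 2) (*-comm 2 k)) ([m+kn]%n≡m%n (exp g) k 2))
    same-residue : exp (g · x²ᵏ) % (2 * k) ≡ exp g % (2 * k)
    same-residue = trans (∣⇒%≡ 2k∣n (exp-·x²ᵏ g)) ([m+n]%n≡m%n (exp g) (2 * k))

  class-index : G → ℕ
  class-index (b , a) = (if b then 3 * k else 0) + index (toℕ a)

  class-index<6k : ∀ g → class-index g < 6 * k
  class-index<6k (false , a) = <-≤-trans (index<3k (exp<n (false , a))) (*-monoˡ-≤ k {3} {6} (s≤s (s≤s (s≤s z≤n))))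
  class-index<6k (true  , a) = subst (3 * k + index (toℕ a) <_) 3k+3k≡6k (+-monoʳ-< (3 * k) (index<3k (exp<n (true , a))))
    where
    3k+3k≡6k : 3 * k + 3 * k ≡ 6 * k
    3k+3k≡6k = solve (k ∷ [])

  opaque
    cc : G → Fin (6 * k)
    cc g = fromℕ< (class-index<6k g)

    cc-injective : ∀ g h → cc g ≡ cc h → class-index g ≡ class-index h
    cc-injective g h eq =
      trans (sym (Fin.toℕ-fromℕ< (class-index<6k g))) (trans (cong toℕ eq) (Fin.toℕ-fromℕ< (class-index<6k h)))

    cc-surjective : ∀ i → ∃ λ g → cc g ≡ i
    cc-surjective i with toℕ i <? 3 * k
    ... | yes i<3k = let (a , a<n , index-a) = index-surjective i<3k in
      (false , md a) , Fin.toℕ-injective (trans (Fin.toℕ-fromℕ< _) (trans (cong index (toℕ-md< a<n)) index-a))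
    ... | no i≮3k = let (a , a<n , index-a) = index-surjective j<3k in
      (true , md a) , Fin.toℕ-injective (trans (Fin.toℕ-fromℕ< _)
        (trans (cong (λ t → 3 * k + index t) (toℕ-md< a<n))
               (trans (cong (3 * k +_) index-a) (m+[n∸m]≡n (≮⇒≥ i≮3k)))))
      where
      3k+3k≡6k : 3 * k + 3 * k ≡ 6 * k
      3k+3k≡6k = solve (k ∷ [])
      j<3k : toℕ i ∸ 3 * k < 3 * k
      j<3k = +-cancelˡ-< (3 * k) _ _ (subst₂ _<_ (sym (m+[n∸m]≡n (≮⇒≥ i≮3k))) (sym 3k+3k≡6k) (Fin.toℕ<n i))

  index-fibre-G : ∀ g h → bit g ≡ bit h → index (exp g) ≡ index (exp h) → h ≡ g ⊎ h ≡ ψ g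
  index-fibre-G g h bits eq with index-fibre (exp<n g) (exp<n h) eq
  ... | inj₁ a≡a′ = inj₁ (≡-by-exp (sym bits) (≡⇒≈ (sym a≡a′)))
  ... | inj₂ (odd , a′≈a+2k) =
    inj₂ (trans (≡-by-exp bits′ (≈-trans a′≈a+2k (≈-sym (exp-·x²ᵏ g)))) (sym (ψ-odd g odd)))
    where
    bits′ : bit h ≡ bit (g · x²ᵏ)
    bits′ = trans (sym bits) (sym (xor-identityʳ (bit g)))

  class-fibre : ∀ g h → class-index g ≡ class-index h → h ≡ g ⊎ h ≡ ψ g
  class-fibre (false , a) (true , a′) eq =
    ⊥-elim (<⇒≱ (index<3k (exp<n (false , a))) (subst (3 * k ≤_) (sym eq) (m≤m+n (3 * k) _)))
  class-fibre (true , a) (false , a′) eq =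
    ⊥-elim (<⇒≱ (index<3k (exp<n (false , a′))) (subst (3 * k ≤_) eq (m≤m+n (3 * k) _)))
  class-fibre (false , a) (false , a′) eq = index-fibre-G (false , a) (false , a′) refl eq
  class-fibre (true  , a) (true  , a′) eq = index-fibre-G (true , a) (true , a′) refl (+-cancelˡ-≡ (3 * k) _ _ eq)

  class-index-ψ : ∀ g → class-index (ψ g) ≡ class-index g
  class-index-ψ g with parity-cases g
  ... | inj₁ even = cong class-index (ψ-even g even)
  ... | inj₂ odd  = trans (cong class-index (ψ-odd g odd)) (shift g odd)
    where
    shift : ∀ g → parity g ≡ 1 → class-index (g · x²ᵏ) ≡ class-index g
    shift (false , a) odd = index-·x²ᵏ (false , a) odd
    shift (true  , a) odd = cong (3 * k +_) (index-·x²ᵏ (true , a) odd)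

  opaque
    unfolding cc

    cc-ψ : ∀ g → cc (ψ g) ≡ cc g
    cc-ψ g = Fin.toℕ-injective (trans (Fin.toℕ-fromℕ< _) (trans (class-index-ψ g) (sym (Fin.toℕ-fromℕ< _))))

  cc-SRing : IsSRing cc
  cc-SRing = orbit-partition-SRing cc cc-surjective cc-ψ (λ g h eq → class-fibre g h (cc-injective g h eq))
    where open InvolutiveAutomorphism k ψ ψ-· ψ-involutive using (orbit-partition-SRing)

  Z-union-cc : UnionOfBasic Z cc
  Z-union-cc g h eq with class-fibre g h (cc-injective g h eq)
  ... | inj₁ refl = refl
  ... | inj₂ refl = sym (Z-ψ g)

  Z-x²ᵏ·x : Z (x²ᵏ · x) ≡ false
  Z-x²ᵏ·x = Z-rotation⁻ (proj₂ (x²ᵏ · x))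
    (λ r → case trans (sym (res₄-·-by x²ᵏ x (res₄-q4 false 2) (res₄-md false 1))) r of λ ())

  Z-x²ᵏ·x²ᵏ⁺¹ : Z (x²ᵏ · x²ᵏ⁺¹) ≡ false
  Z-x²ᵏ·x²ᵏ⁺¹ = Z-rotation⁻ (proj₂ (x²ᵏ · x²ᵏ⁺¹))
    (λ r → case trans (sym (res₄-·-by x²ᵏ x²ᵏ⁺¹ (res₄-q4 false 2) (res₄-q4 false 3))) r of λ ())

  x²ᵏ⁺¹≡x·x²ᵏ : x²ᵏ⁺¹ ≡ x · x²ᵏ
  x²ᵏ⁺¹≡x·x²ᵏ = sym (·-md {false} refl ≈-refl)

  parity-x⁻¹ : parity (inv x) ≡ 1
  parity-x⁻¹ = trans (cong parity inv-x) (trans (parity-≈ (exp-md false (3 + q * 8)))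
    (trans (cong (λ t → (3 + t) % 2) (sym (*-assoc q 4 2))) ([m+kn]%n≡m%n 3 (q * 4) 2)))

  even-rotation : ∀ m → (false , md (m * 2)) · x² ≡ (false , md (suc m * 2))
  even-rotation m = ·-md {false} refl (≡⇒≈ (+-comm (m * 2) 2))

  y·rotation : ∀ a → y · (false , md a) ≡ (true , md a)
  y·rotation a = ·-md {true} refl ≈-refl

  module Minimality {r} (d : G → Fin r) (d-SRing : IsSRing d) (Z-union : UnionOfBasic Z d) where
    open SRingProperties k d d-SRing
    open Counting _≟P_ using (length-filter-≥; length-filter-≤)
    open Algebra.Properties.Group dihedral using (//-rightDividesˡ; \\-leftDividesˡ)

    private
      d-identity = proj₁ (proj₂ d-SRing)
      d-inv = proj₁ (proj₂ (proj₂ d-SRing))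

    Z-class : ∀ {g h} → d g ≡ d h → Z g ≡ Z h
    Z-class {g} {h} = Z-union g h

    #Z·Z : G → ℕ
    #Z·Z = #S·S Z Z-union

    three-factorisations : 3 ≤ #Z·Z yx⁻²
    three-factorisations = length-filter-≥ pairs-unique pairs-complete (inS·S? Z Z-union yx⁻²) distinct
      (  ((Z-x² , Z-y) , x²·y)
      All.∷ ((Z-y , Z-x⁻²) , y·x⁻²)
      All.∷ ((Z-yx⁻⁴ , Z-x²) , yx⁻⁴·x²)
      All.∷ All.[])
      where
      y≢yx⁻⁴ : y ≢ yx⁻⁴
      y≢yx⁻⁴ eq = q≢0 (m*n≡0⇒m≡0 q 8 (sym (md-injective (>-nonZero⁻¹ n) (<n 0 8 z<s ≤-refl) eq)))
      distinct : Unique ((x² , y) ∷ (y , x⁻²) ∷ (yx⁻⁴ , x²) ∷ [])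
      distinct = ((λ ()) All.∷ (λ ()) All.∷ All.[])
        AllPairs.∷ ((λ eq → y≢yx⁻⁴ (cong proj₁ eq)) All.∷ All.[])
        AllPairs.∷ All.[] AllPairs.∷ AllPairs.[]

    at-most-two-factorisations : ∀ {z} → Z z ≡ true → z ≢ yx⁻² → #Z·Z z ≤ 2
    at-most-two-factorisations {z} Zz z≢yx⁻² =
      length-filter-≤ pairs-unique pairs-complete (inS·S? Z Z-union z) (λ {p} → pivot-pairs p)
      where
      p = pivot z
      pivot-pairs : ∀ ab → InS·S Z Z-union z ab → ab ∈ (p , inv p · z) ∷ (z · inv p , p) ∷ []
      pivot-pairs (a , b) ((Za , Zb) , refl) with pivot-factor a b Za Zb Zz z≢yx⁻²
      ... | inj₁ a≡p = here (cong₂ _,_ a≡p b≡)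
        where b≡ = trans (sym (\\-leftDividesʳ a b)) (cong (λ t → inv t · (a · b)) a≡p)
      ... | inj₂ b≡p = there (here (cong₂ _,_ a≡ b≡p))
        where a≡ = trans (sym (//-rightDividesʳ b a)) (cong (λ t → (a · b) · inv t) b≡p)

    yx⁻²-singleton : Singleton yx⁻²
    yx⁻²-singleton z dz≡ with z ≟G yx⁻²
    ... | yes z≡yx⁻² = z≡yx⁻²
    ... | no z≢yx⁻² = ⊥-elim (<⇒≱ (s≤s (s≤s (s≤s z≤n)))
      (≤-trans three-factorisations (subst (_≤ 2) (#S·S-constant Z Z-union dz≡)
        (at-most-two-factorisations (trans (Z-class dz≡) Z-yx⁻²) z≢yx⁻²))))

    x-class : ∀ {u} → d u ≡ d x → u ≡ x ⊎ u ≡ x²ᵏ⁺¹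
    x-class {u} du≡dx = x-class-candidates u
      (trans (Z-class du≡dx) Z-x)
      (trans (Z-class (translate yx⁻²-singleton du≡dx)) (trans (cong Z yx⁻²·x) Z-yx⁻¹))
      (trans (Z-class (translate yx⁻²-singleton (d-inv u x du≡dx))) (trans (cong Z yx⁻²·x⁻¹) Z-yx⁻³))

    yx⁻¹-class : ∀ {τ} → d τ ≡ d yx⁻¹ → τ ≡ x²ᵏ ⊎ τ ≡ yx²ᵏ⁻¹ ⊎ τ ≡ yx⁻¹
    yx⁻¹-class {τ} dτ≡ = yx⁻¹-class-candidates τ
      (trans (Z-class dτ≡) Z-yx⁻¹)
      (trans (Z-class (translate yx⁻²-singleton dτ≡)) (trans (cong Z yx⁻²·yx⁻¹) Z-x))
      (λ τ≡yx⁻² → yx⁻¹≢yx⁻² (yx⁻²-singleton yx⁻¹ (trans (sym dτ≡) (cong d τ≡yx⁻²))))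

    y-singleton : Singleton y
    y-singleton z dz≡dy with factorisation-lift (sym dz≡dy) yx⁻¹·x
    ... | τ , u , dτ≡ , du≡ , τu≡z = product (yx⁻¹-class dτ≡) (x-class du≡)
      where
      Zτu : Z (τ · u) ≡ true
      Zτu = trans (cong Z τu≡z) (trans (Z-class dz≡dy) Z-y)
      outside : ∀ {a b} → τ ≡ a → u ≡ b → Z (a · b) ≡ false → z ≡ y
      outside refl refl Zab = ⊥-elim (true≢false (trans (sym Zτu) Zab))
      inside : ∀ {a b} → τ ≡ a → u ≡ b → a · b ≡ y → z ≡ y
      inside refl refl ab≡y = trans (sym τu≡z) ab≡y
      product : τ ≡ x²ᵏ ⊎ τ ≡ yx²ᵏ⁻¹ ⊎ τ ≡ yx⁻¹ → u ≡ x ⊎ u ≡ x²ᵏ⁺¹ → z ≡ y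
      product (inj₁ τ≡)        (inj₁ u≡) = outside τ≡ u≡ Z-x²ᵏ·x
      product (inj₁ τ≡)        (inj₂ u≡) = outside τ≡ u≡ Z-x²ᵏ·x²ᵏ⁺¹
      product (inj₂ (inj₁ τ≡)) (inj₁ u≡) = outside τ≡ u≡ (trans (cong Z yx²ᵏ⁻¹·x) Z-yx²ᵏ)
      product (inj₂ (inj₁ τ≡)) (inj₂ u≡) = inside τ≡ u≡ yx²ᵏ⁻¹·x²ᵏ⁺¹
      product (inj₂ (inj₂ τ≡)) (inj₁ u≡) = inside τ≡ u≡ yx⁻¹·x
      product (inj₂ (inj₂ τ≡)) (inj₂ u≡) = outside τ≡ u≡ (trans (cong Z yx⁻¹·x²ᵏ⁺¹) Z-yx²ᵏ)

    x²-singleton : Singleton x²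
    x²-singleton = subst Singleton yx⁻²·y (singleton-· yx⁻²-singleton y-singleton)

    even-rotation-singleton : ∀ m → Singleton (false , md (m * 2))
    even-rotation-singleton zero    = d-identity
    even-rotation-singleton (suc m) = subst Singleton (even-rotation m) (singleton-· (even-rotation-singleton m) x²-singleton)

    even-singleton : ∀ g → parity g ≡ 0 → Singleton g
    even-singleton (b , a) even = subst Singleton (sym g≡) (by-bit b)
      where
      g≡ : (b , a) ≡ (b , md (toℕ a / 2 * 2))
      g≡ = ≡-md (≡⇒≈ (trans (m≡m%n+[m/n]*n (toℕ a) 2) (cong (_+ toℕ a / 2 * 2) even)))
      by-bit : ∀ b → Singleton (b , md (toℕ a / 2 * 2))
      by-bit false = even-rotation-singleton (toℕ a / 2)
      by-bit true  = subst Singleton (y·rotation _) (singleton-· y-singleton (even-rotation-singleton (toℕ a / 2)))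

    odd-class : ∀ g h → parity g ≡ 1 → d g ≡ d h → h ≡ g ⊎ h ≡ ψ g
    odd-class g h odd dg≡dh = cosets (x-class dt⁻¹h≡dx)
      where
      open ≡-Reasoning
      t = g · inv x
      t·x≡g : t · x ≡ g
      t·x≡g = //-rightDividesˡ x g
      t! : Singleton t
      t! = even-singleton t (trans (parity-·′ g (inv x)) (cong₂ (λ s t → (s + t) % 2) odd parity-x⁻¹))
      dt⁻¹h≡dx : d (inv t · h) ≡ d x
      dt⁻¹h≡dx = trans (sym (translate t! dg≡dh))
                       (cong d (trans (cong (inv t ·_) (sym t·x≡g)) (\\-leftDividesʳ t x)))
      cosets : inv t · h ≡ x ⊎ inv t · h ≡ x²ᵏ⁺¹ → h ≡ g ⊎ h ≡ ψ g
      cosets (inj₁ t⁻¹h≡x) = inj₁ (begin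
        h                    ≡⟨ \\-leftDividesˡ t h ⟨
        t · (inv t · h)      ≡⟨ cong (t ·_) t⁻¹h≡x ⟩
        t · x                ≡⟨ t·x≡g ⟩
        g                    ∎)
      cosets (inj₂ t⁻¹h≡x²ᵏ⁺¹) = inj₂ (begin
        h                    ≡⟨ \\-leftDividesˡ t h ⟨
        t · (inv t · h)      ≡⟨ cong (t ·_) (trans t⁻¹h≡x²ᵏ⁺¹ x²ᵏ⁺¹≡x·x²ᵏ) ⟩
        t · (x · x²ᵏ)        ≡⟨ ·-assoc t x x²ᵏ ⟨
        (t · x) · x²ᵏ        ≡⟨ cong (_· x²ᵏ) t·x≡g ⟩
        g · x²ᵏ              ≡⟨ ψ-odd g odd ⟨
        ψ g                  ∎)

    refines-cc : ∀ g h → d g ≡ d h → cc g ≡ cc h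
    refines-cc g h dg≡dh = by-parity (parity-cases g)
      where
      same-orbit : h ≡ g ⊎ h ≡ ψ g → cc g ≡ cc h
      same-orbit (inj₁ h≡g)  = cong cc (sym h≡g)
      same-orbit (inj₂ h≡ψg) = trans (sym (cc-ψ g)) (cong cc (sym h≡ψg))
      by-parity : parity g ≡ 0 ⊎ parity g ≡ 1 → cc g ≡ cc h
      by-parity (inj₁ even) = same-orbit (inj₁ (even-singleton g even h (sym dg≡dh)))
      by-parity (inj₂ odd)  = same-orbit (odd-class g h odd dg≡dh)

  wl-rank : WLRank≡ Z (6 * k)
  wl-rank = cc , cc-SRing , Z-union-cc , λ _ d d-SRing Z-union → Minimality.refines-cc d d-SRing Z-union

lemma5p3 : (k : ℕ) .{{_ : NonZero k}} → 3 ≤ k → k % 2 ≡ 1 →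
    Dihedral.WLRank≡ k (Dihedral.Z k) (6 * k)
lemma5p3 k k≥3 k-odd = OddDihedral.wl-rank k (k / 2) k≡1+2q q≢0
  where
  k≡1+2q : k ≡ 1 + k / 2 * 2
  k≡1+2q = trans (m≡m%n+[m/n]*n k 2) (cong (_+ k / 2 * 2) k-odd)
  q≢0 : k / 2 ≢ 0
  q≢0 q≡0 = <⇒≱ (s≤s (s≤s z≤n)) (subst (3 ≤_) (trans k≡1+2q (cong (λ q → 1 + q * 2) q≡0)) k≥3)
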